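{- Let $r\ge1$ and let $f,F$ be functions of $x$ with $F(x)=f(x)\prod_{n\ge0}\frac{1-dxu_rq^n}{1-xq^n}$. Then [$f(0)=1$ and $f$ satisfies $(\mathrm{eq}_r)$] if and only if [$F(0)=1$ and $F$ satisfies $$\Big(1+\sum_{i=1}^r(-x)^i\big(d^{i-1}e_{i-1}(u_1,\dots,u_{r-1})+d^ie_i(u_1,\dots,u_{r-1})\big)\Big)F(x)=F(xq)+\sum_{i=1}^r\sum_{\ell=1}^r\sum_{k=0}^{\min(i-1,\ell-1)}c_{k,i}\,b_{\ell-k,i}\,(-1)^{\ell-1}x^\ell F(xq^i)\Big],$$ where $c_{k,i}:=d^ku_r^kq^{k(k+1)/2}{i-1\brack k}_q$ and $b_{m,i}:=\big(d^{m-1}e_{i+m-1}(u_1,\dots,u_r)+d^me_{i+m}(u_1,\dots,u_r)\big){i+m-1\brack m-1}_q$.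
   Context: $(\mathrm{eq}_r)$ is the equation $\prod_{i=1}^r(1-dxu_i)f(x)=f(xq)+\sum_{i=1}^r\Big(\sum_{m=0}^{r-i}d^m x\,e_{i+m}(u_1,\dots,u_r)\big((-x)^{m-1}{i+m-1\brack m-1}_q+(-x)^m{i+m\brack m}_q\big)\Big)\prod_{h=1}^{i-1}(1-xq^h)f(xq^i)$. Functions are functions of $x$ with $u_1,\dots,u_r,d,q$ as parameters. ${m\brack s}_q=\prod_{t=0}^{s-1}\frac{1-q^{m-t}}{1-q^{t+1}}$ for $0\le s\le m$, and $0$ otherwise. $e_n(u_1,\dots,u_s)$ is the $n$-th elementary symmetric polynomial in $u_1,\dots,u_s$ (the sum of $u_1^{\epsilon_1(j)}\cdots u_s^{\epsilon_s(j)}$ over $1\le j<2^s$ having exactly $n$ binary digits $\epsilon_k(j)$ equal to $1$), with the convention $e_0=1$ and $e_n=0$ for $n<0$ or $n>s$. -}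

module Defs where

open import Algebra.Bundles using (CommutativeRing)
open import Data.Nat as ℕ using (ℕ; zero; suc; _∸_; _≟_; _≤?_)
open import Data.Nat.DivMod using (_/_)
open import Data.Nat.Divisibility using (_∣?_)
open import Data.Bool using (Bool; true; false; if_then_else_; _∧_)
open import Data.List using (List; []; _∷_; map; _++_)
open import Data.Vec using (Vec; []; _∷_; init; last)
open import Data.Product using (_×_)
open import Relation.Nullary using (does)

-- All subsets of {1..s}, encoded as Bool vectors (the binary digits ε_k(j)).
allBools : (s : ℕ) → List (Vec Bool s)
allBools zero = [] ∷ []
allBools (suc s) = map (false ∷_) (allBools s) ++ map (true ∷_) (allBools s)

countTrue : ∀ {s} → Vec Bool s → ℕ
countTrue [] = 0
countTrue (false ∷ b) = countTrue b
countTrue (true ∷ b) = suc (countTrue b)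

module Def {c ℓ} (R : CommutativeRing c ℓ) where
  open CommutativeRing R

  powR : Carrier → ℕ → Carrier
  powR a zero = 1#
  powR a (suc n) = a * powR a n

  sumList : List Carrier → Carrier
  sumList [] = 0#
  sumList (a ∷ as) = a + sumList as

  prodSel : ∀ {s} → Vec Bool s → Vec Carrier s → Carrier
  prodSel [] [] = 1#
  prodSel (false ∷ b) (_ ∷ us) = prodSel b us
  prodSel (true ∷ b) (u ∷ us) = u * prodSel b us

  esym : ∀ {s} → ℕ → Vec Carrier s → Carrier
  esym {s} n us = sumList (map (λ b → if does (countTrue b ≟ n) then prodSel b us else 0#) (allBools s))

  sumℕ : ℕ → (ℕ → Carrier) → Carrier
  sumℕ zero g = 0#
  sumℕ (suc n) g = sumℕ n g + g n

  -- Formal series in x with coefficients formal power series in q: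
  -- ser a b is the coefficient of x^a q^b.
  Ser : Set c
  Ser = ℕ → ℕ → Carrier

  infix 4 _≋_
  _≋_ : Ser → Ser → Set ℓ
  f ≋ g = ∀ a b → f a b ≈ g a b

  infixl 6 _⊕_ _⊖_
  infixl 7 _⊗_

  _⊕_ : Ser → Ser → Ser
  (f ⊕ g) a b = f a b + g a b

  ⊝_ : Ser → Ser
  (⊝ f) a b = - f a b

  _⊖_ : Ser → Ser → Ser
  f ⊖ g = f ⊕ (⊝ g)

  _⊗_ : Ser → Ser → Ser
  (f ⊗ g) a b = sumℕ (suc a) (λ i → sumℕ (suc b) (λ j → f i j * g (a ∸ i) (b ∸ j)))

  zeroS : Ser
  zeroS _ _ = 0#

  mono : ℕ → ℕ → Ser
  mono i j a b = if does (a ≟ i) ∧ does (b ≟ j) then 1# else 0#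

  oneS : Ser
  oneS = mono 0 0

  X : Ser
  X = mono 1 0

  qmono : ℕ → Ser
  qmono j = mono 0 j

  scal : Carrier → Ser
  scal k a b = if does (a ≟ 0) ∧ does (b ≟ 0) then k else 0#

  powS : Ser → ℕ → Ser
  powS f zero = oneS
  powS f (suc n) = f ⊗ powS f n

  sumS : ℕ → ℕ → (ℕ → Ser) → Ser
  sumS lo hi g a b = sumℕ (suc hi ∸ lo) (λ j → g (lo ℕ.+ j) a b)

  prodS : ℕ → (ℕ → Ser) → Ser
  prodS zero g = oneS
  prodS (suc n) g = prodS n g ⊗ g n

  prodFT : ℕ → ℕ → (ℕ → Ser) → Ser
  prodFT lo hi g = prodS (suc hi ∸ lo) (λ j → g (lo ℕ.+ j))

  -- substitution f(x) ↦ f(x q^i)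
  subst : Ser → ℕ → Ser
  subst f i a b = if does (i ℕ.* a ≤? b) then f a (b ∸ i ℕ.* a) else 0#

  -- 1/(1 - q^k) = Σ_n q^{kn}   (used for k ≥ 1)
  geomq : ℕ → Ser
  geomq k a b = if does (a ≟ 0) ∧ does (k ∣? b) then 1# else 0#

  -- 1/(1 - x q^n) = Σ_a x^a q^{na}
  geomx : ℕ → Ser
  geomx n a b = if does (n ℕ.* a ≟ b) then 1# else 0#

  qbin : ℕ → ℕ → Ser
  qbin m s = if does (s ≤? m)
             then prodS s (λ t → (oneS ⊖ qmono (m ∸ t)) ⊗ geomq (suc t))
             else zeroS

  AtZeroOne : Ser → Set ℓ
  AtZeroOne f = (f 0 0 ≈ 1#) × (∀ b → f 0 (suc b) ≈ 0#)

  negX : Ser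
  negX = ⊝ X

  module Params (r' : ℕ) (u : Vec Carrier (suc r')) (d : Carrier) where
    r : ℕ
    r = suc r'

    ur : Carrier
    ur = last u

    u⁻ : Vec Carrier r'
    u⁻ = init u

    prodVec : ∀ {s} → Vec Carrier s → (Carrier → Ser) → Ser
    prodVec [] g = oneS
    prodVec (v ∷ vs) g = g v ⊗ prodVec vs g

    -- Π_{n ≥ 0} (1 - d x u_r q^n)/(1 - x q^n): the coefficient of x^a q^b is
    -- that of the finite product over n = 0..b (the factors with n > b are
    -- ≡ 1 modulo q^{b+1}), i.e. the q-adic limit of the partial products.
    factor : ℕ → Ser
    factor n = (oneS ⊖ scal (d * ur) ⊗ mono 1 n) ⊗ geomx n

    Pinf : Ser
    Pinf a b = prodS (suc b) factor a b

    innerr : ℕ → ℕ → Ser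
    innerr i zero = powS negX 0 ⊗ qbin i 0
    innerr i (suc m) = powS negX m ⊗ qbin (i ℕ.+ m) m
                       ⊕ powS negX (suc m) ⊗ qbin (i ℕ.+ suc m) (suc m)

    EqR : Ser → Set ℓ
    EqR f =
      prodVec u (λ ui → oneS ⊖ scal (d * ui) ⊗ X) ⊗ f
      ≋ subst f 1
        ⊕ sumS 1 r (λ i →
            sumS 0 (r ∸ i) (λ m → scal (powR d m * esym (i ℕ.+ m) u) ⊗ X ⊗ innerr i m)
            ⊗ prodFT 1 (i ∸ 1) (λ h → oneS ⊖ mono 1 h)
            ⊗ subst f i)

    cc : ℕ → ℕ → Ser
    cc k i = scal (powR d k * powR ur k) ⊗ qmono ((k ℕ.* suc k) / 2) ⊗ qbin (i ∸ 1) k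

    bb : ℕ → ℕ → Ser
    bb m i = scal (powR d (m ∸ 1) * esym (i ℕ.+ m ∸ 1) u + powR d m * esym (i ℕ.+ m) u)
             ⊗ qbin (i ℕ.+ m ∸ 1) (m ∸ 1)

    EqR' : Ser → Set ℓ
    EqR' F =
      (oneS ⊕ sumS 1 r (λ i → powS negX i
            ⊗ scal (powR d (i ∸ 1) * esym (i ∸ 1) u⁻ + powR d i * esym i u⁻))) ⊗ F
      ≋ subst F 1
        ⊕ sumS 1 r (λ i → sumS 1 r (λ l → sumS 0 (ℕ._⊓_ (i ∸ 1) (l ∸ 1)) (λ k →
            cc k i ⊗ bb (l ∸ k) i ⊗ scal (powR (- 1#) (l ∸ 1)) ⊗ powS X l ⊗ subst F i)))

-- Work in the ring of power series in x over power series in q, and write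
-- P(x) = ∏_{n≥0} (1 - z x q^n)/(1 - x q^n) with z = d u_r, so that F = f P.  Then P(0) = 1 and
-- P(x) (1 - x) = (1 - z x) P(xq), hence P(x) ∏_{h<i} (1 - x q^h) = ∏_{h<i} (1 - z x q^h) P(xq^i).
-- Multiplying the transformed equation for F by 1 - z x and (eq_r) for f by P(x) (1 - x) gives the
-- same identity: on the left ∏_{i≤r} (1 - d u_i x) = ∏_{i<r} (1 - d u_i x) (1 - z x), and on the
-- right the q-binomial theorem expands ∏_{h=1}^{i-1} (1 - z x q^h) times the coefficient of
-- f(xq^i) into the coefficient of F(xq^i).  Both multipliers have constant term 1, so they cancel.

module Submission where

open import Defs
open import Algebra.Bundles using (CommutativeRing)
open import Data.Nat using (ℕ; suc)
open import Data.Vec using (Vec)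
open import Data.Product using (_×_)
open import Function.Bundles using (_⇔_)
open import Data.Nat as ℕ using (_∸_; _≤_)
open import Function.Bundles using (Equivalence; mk⇔)
open import Data.Product.Function.NonDependent.Propositional using (_×-⇔_)

module Sums {c ℓ} (S : CommutativeRing c ℓ) where

  open import Data.Nat as ℕ using (ℕ; zero; suc; _∸_; _<_; _≤_; z≤n; s≤s)
  import Data.Nat.Properties as NP
  open import Data.Empty using (⊥)
  open import Relation.Nullary using (yes; no)
  open import Relation.Binary.PropositionalEquality as P using (_≡_)
  import Relation.Binary.Reasoning.Setoid as SetR
  import Algebra.Properties.CommutativeSemigroup as CSP

  open CommutativeRing S
  open SetR setoid
  open CSP +-commutativeSemigroup using (interchange)

  Σ : ℕ → (ℕ → Carrier) → Carrier
  Σ zero g = 0#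
  Σ (suc n) g = Σ n g + g n

  Σ-cong< : ∀ n {g h : ℕ → Carrier} → (∀ i → i < n → g i ≈ h i) → Σ n g ≈ Σ n h
  Σ-cong< zero e = refl
  Σ-cong< (suc n) e = +-cong (Σ-cong< n (λ i p → e i (NP.m<n⇒m<1+n p))) (e n (NP.n<1+n n))

  Σ-cong : ∀ n {g h : ℕ → Carrier} → (∀ i → g i ≈ h i) → Σ n g ≈ Σ n h
  Σ-cong n e = Σ-cong< n (λ i _ → e i)

  Σ-length : ∀ {n m} (g : ℕ → Carrier) → n ≡ m → Σ n g ≈ Σ m g
  Σ-length g P.refl = refl

  Σ-+ : ∀ n (g h : ℕ → Carrier) → Σ n (λ i → g i + h i) ≈ Σ n g + Σ n h
  Σ-+ zero g h = sym (+-identityˡ 0#)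
  Σ-+ (suc n) g h = trans (+-congʳ (Σ-+ n g h)) (interchange _ _ _ _)

  Σ-*ˡ : ∀ n a (g : ℕ → Carrier) → a * Σ n g ≈ Σ n (λ i → a * g i)
  Σ-*ˡ zero a g = zeroʳ a
  Σ-*ˡ (suc n) a g = trans (distribˡ a _ _) (+-congʳ (Σ-*ˡ n a g))

  Σ-*ʳ : ∀ n a (g : ℕ → Carrier) → Σ n g * a ≈ Σ n (λ i → g i * a)
  Σ-*ʳ zero a g = zeroˡ a
  Σ-*ʳ (suc n) a g = trans (distribʳ a _ _) (+-congʳ (Σ-*ʳ n a g))

  Σ-zero : ∀ n {g : ℕ → Carrier} → (∀ i → i < n → g i ≈ 0#) → Σ n g ≈ 0#
  Σ-zero zero e = refl
  Σ-zero (suc n) e =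
    trans (+-cong (Σ-zero n (λ i p → e i (NP.m<n⇒m<1+n p))) (e n (NP.n<1+n n))) (+-identityˡ 0#)

  Σ-head : ∀ n (g : ℕ → Carrier) → Σ (suc n) g ≈ g 0 + Σ n (λ i → g (suc i))
  Σ-head zero g = trans (+-identityˡ _) (sym (+-identityʳ _))
  Σ-head (suc n) g = trans (+-congʳ (Σ-head n g)) (+-assoc _ _ _)

  Σ-head-only : ∀ n {g : ℕ → Carrier} → (∀ i → 0 < i → i < suc n → g i ≈ 0#) → Σ (suc n) g ≈ g 0
  Σ-head-only n {g} e = trans (Σ-head n g)
    (trans (+-congˡ (Σ-zero n (λ i p → e (suc i) (s≤s z≤n) (s≤s p)))) (+-identityʳ _))

  Σ-reverse : ∀ n (g : ℕ → Carrier) → Σ (suc n) g ≈ Σ (suc n) (λ i → g (n ∸ i))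
  Σ-reverse zero g = refl
  Σ-reverse (suc n) g = begin
    Σ (suc n) g + g (suc n)                  ≈⟨ +-congʳ (Σ-reverse n g) ⟩
    Σ (suc n) (λ i → g (n ∸ i)) + g (suc n)  ≈⟨ +-comm _ _ ⟩
    g (suc n) + Σ (suc n) (λ i → g (n ∸ i))  ≈⟨ sym (Σ-head (suc n) (λ i → g (suc n ∸ i))) ⟩
    Σ (suc (suc n)) (λ i → g (suc n ∸ i))    ∎

  Σ-triangle : ∀ N (A : ℕ → ℕ → Carrier) →
    Σ N (λ i → Σ (suc i) (λ j → A j i)) ≈ Σ N (λ j → Σ (N ∸ j) (λ k → A j (j ℕ.+ k)))
  Σ-triangle zero A = refl
  Σ-triangle (suc N) A = begin
    Σ N (λ i → Σ (suc i) (λ j → A j i)) + Σ (suc N) (λ j → A j N)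
      ≈⟨ +-congʳ (Σ-triangle N A) ⟩
    Σ N (λ j → Σ (N ∸ j) (λ k → A j (j ℕ.+ k))) + Σ (suc N) (λ j → A j N)
      ≈⟨ +-congʳ (sym (trans (+-congˡ (Σ-length _ (NP.n∸n≡0 N))) (+-identityʳ _))) ⟩
    Σ (suc N) (λ j → Σ (N ∸ j) (λ k → A j (j ℕ.+ k))) + Σ (suc N) (λ j → A j N)
      ≈⟨ sym (Σ-+ (suc N) _ _) ⟩
    Σ (suc N) (λ j → Σ (N ∸ j) (λ k → A j (j ℕ.+ k)) + A j N)
      ≈⟨ Σ-cong< (suc N) (λ j p → sym (last-row j (NP.≤-pred p))) ⟩
    Σ (suc N) (λ j → Σ (suc N ∸ j) (λ k → A j (j ℕ.+ k))) ∎
    where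
    last-row : ∀ j → j ≤ N →
      Σ (suc N ∸ j) (λ k → A j (j ℕ.+ k)) ≈ Σ (N ∸ j) (λ k → A j (j ℕ.+ k)) + A j N
    last-row j p rewrite NP.+-∸-assoc 1 p = +-congˡ (reflexive (P.cong (A j) (NP.m+[n∸m]≡n p)))

  Σ-single : ∀ n s {g : ℕ → Carrier} → (∀ m → (m ≡ s → ⊥) → g m ≈ 0#) → (n ≤ s → g s ≈ 0#) →
    Σ n g ≈ g s
  Σ-single zero s z zs = sym (zs z≤n)
  Σ-single (suc n) s {g} z zs with n ℕ.≟ s
  ... | yes P.refl = trans (+-congʳ (Σ-zero n (λ m p → z m (λ e → NP.<⇒≢ p e)))) (+-identityˡ _)
  ... | no ne = trans (+-cong (Σ-single n s z (λ p → zs (NP.≤∧≢⇒< p ne))) (z n ne)) (+-identityʳ _)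

  Σ-pad : ∀ n k {g : ℕ → Carrier} → (∀ m → n ≤ m → m < n ℕ.+ k → g m ≈ 0#) → Σ (n ℕ.+ k) g ≈ Σ n g
  Σ-pad n zero {g} z = Σ-length g (NP.+-identityʳ n)
  Σ-pad n (suc k) {g} z = trans (Σ-length g (NP.+-suc n k))
    (trans (+-cong (Σ-pad n k (λ m p q → z m p (NP.<-≤-trans q (NP.+-monoʳ-≤ n (NP.n≤1+n k)))))
                   (z (n ℕ.+ k) (NP.m≤m+n n k) (NP.+-monoʳ-< n (NP.n<1+n k))))
           (+-identityʳ _))

  Π : ℕ → (ℕ → Carrier) → Carrier
  Π zero g = 1#
  Π (suc n) g = Π n g * g n

  Π-cong : ∀ n {g h : ℕ → Carrier} → (∀ i → g i ≈ h i) → Π n g ≈ Π n h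
  Π-cong zero e = refl
  Π-cong (suc n) e = *-cong (Π-cong n e) (e n)

  Π-head : ∀ n (g : ℕ → Carrier) → Π (suc n) g ≈ g 0 * Π n (λ i → g (suc i))
  Π-head zero g = *-comm 1# (g 0)
  Π-head (suc n) g = trans (*-congʳ (Π-head n g)) (*-assoc _ _ _)

  Π-* : ∀ n (g h : ℕ → Carrier) → Π n (λ i → g i * h i) ≈ Π n g * Π n h
  Π-* zero g h = sym (*-identityˡ 1#)
  Π-* (suc n) g h = trans (*-congʳ (Π-* n g h)) (*-interchange _ _ _ _)
    where open CSP *-commutativeSemigroup renaming (interchange to *-interchange)

  Π-zero : ∀ n k (g : ℕ → Carrier) → k < n → g k ≈ 0# → Π n g ≈ 0#
  Π-zero (suc n) k g p e with k ℕ.≟ n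
  ... | yes P.refl = trans (*-congˡ e) (zeroʳ _)
  ... | no ne = trans (*-congʳ (Π-zero n k g (NP.≤∧≢⇒< (NP.≤-pred p) ne) e)) (zeroˡ _)

module PowerSeries {c ℓ} (S : CommutativeRing c ℓ) where

  open import Algebra.Structures using (IsCommutativeRing)
  open import Data.Nat as ℕ using (ℕ; zero; suc; _∸_; _<_; z≤n; s≤s)
  import Data.Nat.Properties as NP
  open import Data.Product using (_,_)
  import Relation.Binary.PropositionalEquality as P
  import Relation.Binary.Reasoning.Setoid as SetR

  open CommutativeRing S
  open Sums S
  open SetR setoid
  open import Algebra.Properties.Group +-group using (ε⁻¹≈ε)

  PS : Set c
  PS = ℕ → Carrier

  infix 4 _≈ₚ_
  _≈ₚ_ : PS → PS → Set ℓ
  f ≈ₚ g = ∀ n → f n ≈ g n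

  infixl 6 _+ₚ_
  infixl 7 _*ₚ_
  _+ₚ_ : PS → PS → PS
  (f +ₚ g) n = f n + g n

  -ₚ_ : PS → PS
  (-ₚ f) n = - f n

  0ₚ : PS
  0ₚ _ = 0#

  1ₚ : PS
  1ₚ zero = 1#
  1ₚ (suc _) = 0#

  _*ₚ_ : PS → PS → PS
  (f *ₚ g) n = Σ (suc n) (λ i → f i * g (n ∸ i))

  *ₚ-cong : ∀ {f f' g g'} → f ≈ₚ f' → g ≈ₚ g' → f *ₚ g ≈ₚ f' *ₚ g'
  *ₚ-cong e e' n = Σ-cong (suc n) (λ i → *-cong (e i) (e' (n ∸ i)))

  *ₚ-identityˡ : ∀ f → 1ₚ *ₚ f ≈ₚ f
  *ₚ-identityˡ f n = trans (Σ-head-only n z) (*-identityˡ (f n))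
    where
    z : ∀ i → 0 < i → i < suc n → 1ₚ i * f (n ∸ i) ≈ 0#
    z (suc i) _ _ = zeroˡ _

  *ₚ-comm : ∀ f g → f *ₚ g ≈ₚ g *ₚ f
  *ₚ-comm f g n = trans (Σ-reverse n (λ i → f i * g (n ∸ i)))
    (Σ-cong< (suc n) (λ i p → trans (*-comm _ _)
       (*-congʳ (reflexive (P.cong g (NP.m∸[m∸n]≡n (NP.≤-pred p)))))))

  *ₚ-assoc : ∀ f g h → (f *ₚ g) *ₚ h ≈ₚ f *ₚ (g *ₚ h)
  *ₚ-assoc f g h n = begin
    Σ (suc n) (λ i → Σ (suc i) (λ j → f j * g (i ∸ j)) * h (n ∸ i))
      ≈⟨ Σ-cong (suc n) (λ i → Σ-*ʳ (suc i) _ _) ⟩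
    Σ (suc n) (λ i → Σ (suc i) (λ j → f j * g (i ∸ j) * h (n ∸ i)))
      ≈⟨ Σ-triangle (suc n) (λ j i → f j * g (i ∸ j) * h (n ∸ i)) ⟩
    Σ (suc n) (λ j → Σ (suc n ∸ j) (λ k → f j * g ((j ℕ.+ k) ∸ j) * h (n ∸ (j ℕ.+ k))))
      ≈⟨ Σ-cong< (suc n) (λ j p → trans (Σ-length _ (NP.+-∸-assoc 1 (NP.≤-pred p)))
            (Σ-cong (suc (n ∸ j)) (λ k → trans (*-assoc _ _ _)
              (*-congˡ (*-cong (reflexive (P.cong g (NP.m+n∸m≡n j k)))
                               (reflexive (P.cong h (P.sym (NP.∸-+-assoc n j k))))))))) ⟩
    Σ (suc n) (λ j → Σ (suc (n ∸ j)) (λ k → f j * (g k * h ((n ∸ j) ∸ k))))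
      ≈⟨ Σ-cong (suc n) (λ j → sym (Σ-*ˡ (suc (n ∸ j)) _ _)) ⟩
    Σ (suc n) (λ j → f j * Σ (suc (n ∸ j)) (λ k → g k * h ((n ∸ j) ∸ k))) ∎

  *ₚ-distribˡ : ∀ f g h → f *ₚ (g +ₚ h) ≈ₚ f *ₚ g +ₚ f *ₚ h
  *ₚ-distribˡ f g h n = trans (Σ-cong (suc n) (λ i → distribˡ _ _ _)) (Σ-+ (suc n) _ _)

  *ₚ-distribʳ : ∀ f g h → (g +ₚ h) *ₚ f ≈ₚ g *ₚ f +ₚ h *ₚ f
  *ₚ-distribʳ f g h n = trans (Σ-cong (suc n) (λ i → distribʳ _ _ _)) (Σ-+ (suc n) _ _)

  +ₚ-*ₚ-isCommutativeRing : IsCommutativeRing _≈ₚ_ _+ₚ_ _*ₚ_ -ₚ_ 0ₚ 1ₚ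
  +ₚ-*ₚ-isCommutativeRing = record
    { isRing = record
      { +-isAbelianGroup = record
        { isGroup = record
          { isMonoid = record
            { isSemigroup = record
              { isMagma = record
                { isEquivalence = record
                  { refl = λ n → refl ; sym = λ e n → sym (e n) ; trans = λ e e' n → trans (e n) (e' n) }
                ; ∙-cong = λ e e' n → +-cong (e n) (e' n) }
              ; assoc = λ f g h n → +-assoc (f n) (g n) (h n) }
            ; identity = (λ f n → +-identityˡ (f n)) , (λ f n → +-identityʳ (f n)) }
          ; inverse = (λ f n → -‿inverseˡ (f n)) , (λ f n → -‿inverseʳ (f n))
          ; ⁻¹-cong = λ e n → -‿cong (e n) }
        ; comm = λ f g n → +-comm (f n) (g n) }
      ; *-cong = *ₚ-cong
      ; *-assoc = *ₚ-assoc
      ; *-identity = *ₚ-identityˡ , (λ f n → trans (*ₚ-comm f 1ₚ n) (*ₚ-identityˡ f n))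
      ; distrib = *ₚ-distribˡ , *ₚ-distribʳ }
    ; *-comm = *ₚ-comm }

  +ₚ-*ₚ-commutativeRing : CommutativeRing c ℓ
  +ₚ-*ₚ-commutativeRing = record { isCommutativeRing = +ₚ-*ₚ-isCommutativeRing }

  *ₚ-cancel-unit : ∀ g h → g 0 ≈ 1# → g *ₚ h ≈ₚ 0ₚ → h ≈ₚ 0ₚ
  *ₚ-cancel-unit g h g0 gh m = vanishes-below (suc m) m (NP.n<1+n m)
    where
    -- coefficient m of g *ₚ h is h m plus terms in lower coefficients of h
    vanishes-below : ∀ n m → m < n → h m ≈ 0#
    vanishes-below (suc n) m m<n = begin
      h m ≈⟨ sym (*-identityˡ _) ⟩
      1# * h m ≈⟨ *-congʳ (sym g0) ⟩
      g 0 * h m ≈⟨ sym (+-identityʳ _) ⟩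
      g 0 * h m + 0# ≈⟨ +-congˡ (sym (Σ-zero m
        (λ i i<m → trans (*-congˡ (vanishes-below n (m ∸ suc i) (lt i i<m))) (zeroʳ _)))) ⟩
      g 0 * h m + Σ m (λ i → g (suc i) * h (m ∸ suc i)) ≈⟨ sym (Σ-head m _) ⟩
      (g *ₚ h) m ≈⟨ gh m ⟩
      0# ∎
      where
      lt : ∀ i → i < m → m ∸ suc i < n
      lt i i<m = NP.<-≤-trans (NP.∸-monoʳ-< {m} {suc i} {0} (s≤s z≤n) i<m) (NP.≤-pred m<n)

  monomial : ℕ → PS
  monomial zero = 1ₚ
  monomial (suc k) zero = 0#
  monomial (suc k) (suc n) = monomial k n

  shift : ℕ → PS → PS
  shift zero s = s
  shift (suc k) s zero = 0#
  shift (suc k) s (suc n) = shift k s n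

  monomial-* : ∀ k s → monomial k *ₚ s ≈ₚ shift k s
  monomial-* zero s = *ₚ-identityˡ s
  monomial-* (suc k) s zero = trans (+-identityˡ _) (zeroˡ _)
  monomial-* (suc k) s (suc n) = trans (Σ-head (suc n) _)
    (trans (+-cong (zeroˡ _) refl) (trans (+-identityˡ _) (monomial-* k s n)))

  shift-monomial : ∀ j k → shift j (monomial k) ≈ₚ monomial (j ℕ.+ k)
  shift-monomial zero k n = refl
  shift-monomial (suc j) k zero = refl
  shift-monomial (suc j) k (suc n) = shift-monomial j k n

  monomial-+ : ∀ j k → monomial j *ₚ monomial k ≈ₚ monomial (j ℕ.+ k)
  monomial-+ j k n = trans (monomial-* j (monomial k) n) (shift-monomial j k n)

  shift-cong : ∀ k {f g} → f ≈ₚ g → shift k f ≈ₚ shift k g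
  shift-cong zero e n = e n
  shift-cong (suc k) e zero = refl
  shift-cong (suc k) e (suc n) = shift-cong k e n

  shift-+ : ∀ k f g → shift k (f +ₚ g) ≈ₚ shift k f +ₚ shift k g
  shift-+ zero f g n = refl
  shift-+ (suc k) f g zero = sym (+-identityˡ 0#)
  shift-+ (suc k) f g (suc n) = shift-+ k f g n

  shift-shift : ∀ j k f → shift j (shift k f) ≈ₚ shift (j ℕ.+ k) f
  shift-shift zero k f n = refl
  shift-shift (suc j) k f zero = refl
  shift-shift (suc j) k f (suc n) = shift-shift j k f n

  const : Carrier → PS
  const a zero = a
  const a (suc _) = 0#

  const-* : ∀ a f → const a *ₚ f ≈ₚ λ n → a * f n
  const-* a f n = Σ-head-only n z
    where
    z : ∀ i → 0 < i → i < suc n → const a i * f (n ∸ i) ≈ 0#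
    z (suc i) _ _ = zeroˡ _

  const-*-const : ∀ a b → const (a * b) ≈ₚ const a *ₚ const b
  const-*-const a b n = sym (trans (const-* a (const b) n) (z n))
    where
    z : ∀ n → a * const b n ≈ const (a * b) n
    z zero = refl
    z (suc n) = zeroʳ a

  const-neg : ∀ a → const (- a) ≈ₚ -ₚ const a
  const-neg a zero = refl
  const-neg a (suc n) = sym ε⁻¹≈ε

  const-+ : ∀ a b → const (a + b) ≈ₚ const a +ₚ const b
  const-+ a b zero = refl
  const-+ a b (suc n) = sym (+-identityˡ 0#)

  const-1 : const 1# ≈ₚ 1ₚ
  const-1 zero = refl
  const-1 (suc n) = refl

  const-0 : const 0# ≈ₚ 0ₚ
  const-0 zero = refl
  const-0 (suc n) = refl

  const-cong : ∀ {a b} → a ≈ b → const a ≈ₚ const b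
  const-cong e zero = e
  const-cong e (suc n) = refl

  shift-zero : ∀ k → shift k 0ₚ ≈ₚ 0ₚ
  shift-zero zero n = refl
  shift-zero (suc k) zero = refl
  shift-zero (suc k) (suc n) = shift-zero k n

  shift-neg : ∀ k f → shift k (-ₚ f) ≈ₚ -ₚ shift k f
  shift-neg zero f n = refl
  shift-neg (suc k) f zero = sym ε⁻¹≈ε
  shift-neg (suc k) f (suc n) = shift-neg k f n

module RingIdentities {c ℓ} (S : CommutativeRing c ℓ) where

  open import Data.Nat as ℕ using (ℕ; zero; suc)
  import Relation.Binary.Reasoning.Setoid as SetR
  open import Defs

  open CommutativeRing S
  open Def S using (powR)
  open SetR setoid
  open import Algebra.Properties.Ring ring using (-‿distribˡ-*; -‿distribʳ-*)
  open import Algebra.Properties.CommutativeSemigroup *-commutativeSemigroup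
    using (interchange; x∙yz≈y∙xz)
  open import Algebra.Solver.CommutativeMonoid *-commutativeMonoid using (solve; _⊜_; _⊕_)

  powR-cong : ∀ {a b} k → a ≈ b → powR a k ≈ powR b k
  powR-cong zero e = refl
  powR-cong (suc k) e = *-cong e (powR-cong k e)

  powR-* : ∀ a b k → powR (a * b) k ≈ powR a k * powR b k
  powR-* a b zero = sym (*-identityˡ 1#)
  powR-* a b (suc k) = trans (*-congˡ (powR-* a b k)) (interchange a b (powR a k) (powR b k))

  powR-+ : ∀ a m n → powR a (m ℕ.+ n) ≈ powR a m * powR a n
  powR-+ a zero n = sym (*-identityˡ _)
  powR-+ a (suc m) n = trans (*-congˡ (powR-+ a m n)) (sym (*-assoc _ _ _))

  -1*x≈-x : ∀ x → - 1# * x ≈ - x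
  -1*x≈-x x = trans (sym (-‿distribˡ-* 1# x)) (-‿cong (*-identityˡ x))

  powR-neg : ∀ a k → powR (- a) k ≈ powR (- 1#) k * powR a k
  powR-neg a k = trans (powR-cong k (sym (-1*x≈-x a))) (powR-* (- 1#) a k)

  powR-neg-* : ∀ d w k m →
    powR (- (d * w)) k * powR (- 1#) m ≈ (powR d k * powR w k) * powR (- 1#) (k ℕ.+ m)
  powR-neg-* d w k m = begin
    powR (- (d * w)) k * σm           ≈⟨ *-congʳ (trans (powR-neg (d * w) k) (*-congˡ (powR-* d w k))) ⟩
    (σk * B) * σm                     ≈⟨ *-assoc σk B σm ⟩
    σk * (B * σm)                     ≈⟨ x∙yz≈y∙xz σk B σm ⟩
    B * (σk * σm)                     ≈⟨ *-congˡ (sym (powR-+ (- 1#) k m)) ⟩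
    B * powR (- 1#) (k ℕ.+ m)         ∎
    where
    σk σm B : Carrier
    σk = powR (- 1#) k
    σm = powR (- 1#) m
    B = powR d k * powR w k

  1-c+c[1-d]≈1-cd : ∀ C D A → C * D ≈ A → (1# + - C) + C * (1# + - D) ≈ 1# + - A
  1-c+c[1-d]≈1-cd C D A e = begin
    (1# + - C) + C * (1# + - D)       ≈⟨ +-congˡ (distribˡ C 1# (- D)) ⟩
    (1# + - C) + (C * 1# + C * - D)   ≈⟨ +-congˡ
      (+-cong (*-identityʳ C) (trans (sym (-‿distribʳ-* C D)) (-‿cong e))) ⟩
    (1# + - C) + (C + - A)            ≈⟨ +-assoc 1# (- C) (C + - A) ⟩
    1# + (- C + (C + - A))            ≈⟨ +-congˡ (sym (+-assoc (- C) C (- A))) ⟩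
    1# + ((- C + C) + - A)            ≈⟨ +-congˡ (+-congʳ (-‿inverseˡ C)) ⟩
    1# + (0# + - A)                   ≈⟨ +-congˡ (+-identityˡ (- A)) ⟩
    1# + - A                          ∎

  -- The q-Pascal rule after clearing the denominators G' of the Gaussian binomials.
  pascal-numerators : ∀ N G' C D A → C * D ≈ A →
    (N * (1# + - C)) * G' + C * (N * (G' * (1# + - D))) ≈ ((1# + - A) * N) * G'
  pascal-numerators N G' C D A e = begin
    (N * (1# + - C)) * G' + C * (N * (G' * (1# + - D)))
      ≈⟨ +-cong (solve 3 (λ N C G' → (N ⊕ C) ⊕ G' ⊜ (N ⊕ G') ⊕ C) refl N (1# + - C) G')
                (solve 4 (λ C N G' D → C ⊕ (N ⊕ (G' ⊕ D)) ⊜ (N ⊕ G') ⊕ (C ⊕ D)) refl C N G' (1# + - D)) ⟩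
    (N * G') * (1# + - C) + (N * G') * (C * (1# + - D)) ≈⟨ sym (distribˡ (N * G') _ _) ⟩
    (N * G') * ((1# + - C) + C * (1# + - D))           ≈⟨ *-congˡ (1-c+c[1-d]≈1-cd C D A e) ⟩
    (N * G') * (1# + - A)                               ≈⟨ solve 3 (λ N G' A → (N ⊕ G') ⊕ A ⊜ (A ⊕ N) ⊕ G')
      refl N G' (1# + - A) ⟩
    ((1# + - A) * N) * G'                               ∎

  pascal-numerators-zero : ∀ N G' C D A → N ≈ 0# →
    (N * (1# + - C)) * G' + C * (N * (G' * (1# + - D))) ≈ ((1# + - A) * N) * G'
  pascal-numerators-zero N G' C D A e = begin
    (N * (1# + - C)) * G' + C * (N * (G' * (1# + - D)))
      ≈⟨ +-cong (trans (*-congʳ (trans (*-congʳ e) (zeroˡ _))) (zeroˡ _))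
                (trans (*-congˡ (trans (*-congʳ e) (zeroˡ _))) (zeroʳ _)) ⟩
    0# + 0#                           ≈⟨ +-identityˡ 0# ⟩
    0#                                ≈⟨ sym (trans (*-congʳ (trans (*-congˡ e) (zeroʳ _))) (zeroˡ _)) ⟩
    ((1# + - A) * N) * G'             ∎

  esym-coefficient-step : ∀ d p w e e' →
    (- d * p) * (e' + w * e) ≈ (- d * p) * e' + - ((d * w) * (p * e))
  esym-coefficient-step d p w e e' = trans (distribˡ (- d * p) e' (w * e))
    (+-congˡ (trans (*-congʳ (sym (-‿distribˡ-* d p)))
      (trans (sym (-‿distribˡ-* (d * p) (w * e))) (-‿cong (interchange d p w e)))))

  signed-power-split : ∀ d s e e' →
    (- 1# * powR (- 1#) s) * (powR d s * e + (d * powR d s) * e') ≈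
    powR (- d) (suc s) * e' + - (powR (- d) s * e)
  signed-power-split d s e e' = begin
    (- 1# * σ) * (ds * e + (d * ds) * e')                ≈⟨ distribˡ (- 1# * σ) _ _ ⟩
    (- 1# * σ) * (ds * e) + (- 1# * σ) * ((d * ds) * e') ≈⟨ +-cong first second ⟩
    - (powR (- d) s * e) + powR (- d) (suc s) * e'       ≈⟨ +-comm _ _ ⟩
    powR (- d) (suc s) * e' + - (powR (- d) s * e)       ∎
    where
    σ ds : Carrier
    σ = powR (- 1#) s
    ds = powR d s
    first : (- 1# * σ) * (ds * e) ≈ - (powR (- d) s * e)
    first = trans (*-congʳ (-1*x≈-x σ)) (trans (sym (-‿distribˡ-* σ (ds * e)))
              (-‿cong (trans (sym (*-assoc σ ds e)) (*-congʳ (sym (powR-neg d s))))))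
    second : (- 1# * σ) * ((d * ds) * e') ≈ powR (- d) (suc s) * e'
    second = trans (sym (*-assoc _ _ e')) (*-congʳ (trans (*-congʳ (-1*x≈-x σ))
               (trans (sym (-‿distribˡ-* σ (d * ds)))
                 (trans (-‿cong (x∙yz≈y∙xz σ d ds)) (trans (-‿distribˡ-* d (σ * ds))
                   (*-congˡ (sym (powR-neg d s))))))))

  *-exchange-scalar : ∀ a x y σ e w b σ' → a * σ ≈ b * σ' →
    (a * (x * y)) * (σ * (e * w)) ≈ (((b * x) * y) * (e * w)) * σ'
  *-exchange-scalar a x y σ e w b σ' eq = begin
    (a * (x * y)) * (σ * (e * w))         ≈⟨ solve 6
      (λ a x y σ e w → (a ⊕ (x ⊕ y)) ⊕ (σ ⊕ (e ⊕ w)) ⊜ (a ⊕ σ) ⊕ (e ⊕ (x ⊕ (y ⊕ w)))) refl a x y σ e w ⟩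
    (a * σ) * (e * (x * (y * w)))         ≈⟨ *-congʳ eq ⟩
    (b * σ') * (e * (x * (y * w)))        ≈⟨ solve 6
      (λ b σ' x y e w → (b ⊕ σ') ⊕ (e ⊕ (x ⊕ (y ⊕ w))) ⊜ (((b ⊕ x) ⊕ y) ⊕ (e ⊕ w)) ⊕ σ') refl b σ' x y e w ⟩
    (((b * x) * y) * (e * w)) * σ'        ∎

  module _ {D P L sf sP sF : Carrier} (sF≈ : sF ≈ sf * sP) where

    scaled-shift : P * L ≈ D * sP → D * sF ≈ (P * L) * sf
    scaled-shift PL≈ = begin
      D * sF         ≈⟨ *-congˡ sF≈ ⟩
      D * (sf * sP)  ≈⟨ solve 3 (λ D sf sP → D ⊕ (sf ⊕ sP) ⊜ (D ⊕ sP) ⊕ sf) refl D sf sP ⟩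
      (D * sP) * sf  ≈⟨ *-congʳ (sym PL≈) ⟩
      (P * L) * sf   ∎

    scaled-term : ∀ {ΠL T T′ Πx Πx₁ ΠD} → T′ ≈ ΠL * T → ΠD ≈ D * ΠL → P * Πx₁ ≈ ΠD * sP →
      Πx₁ ≈ L * Πx → D * (T′ * sF) ≈ (P * L) * ((T * Πx) * sf)
    scaled-term {ΠL} {T} {T′} {Πx} {Πx₁} {ΠD} T′≈ ΠD≈ PΠ≈ Πx₁≈ = begin
      D * (T′ * sF)                   ≈⟨ *-congˡ (*-cong T′≈ sF≈) ⟩
      D * ((ΠL * T) * (sf * sP))      ≈⟨ solve 5
        (λ D ΠL T sf sP → D ⊕ ((ΠL ⊕ T) ⊕ (sf ⊕ sP)) ⊜ ((D ⊕ ΠL) ⊕ sP) ⊕ (T ⊕ sf)) refl D ΠL T sf sP ⟩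
      ((D * ΠL) * sP) * (T * sf)      ≈⟨ *-congʳ (*-congʳ (sym ΠD≈)) ⟩
      (ΠD * sP) * (T * sf)            ≈⟨ *-congʳ (sym PΠ≈) ⟩
      (P * Πx₁) * (T * sf)            ≈⟨ *-congʳ (*-congˡ Πx₁≈) ⟩
      (P * (L * Πx)) * (T * sf)       ≈⟨ solve 5
        (λ P L Πx T sf → (P ⊕ (L ⊕ Πx)) ⊕ (T ⊕ sf) ⊜ (P ⊕ L) ⊕ ((T ⊕ Πx) ⊕ sf)) refl P L Πx T sf ⟩
      (P * L) * ((T * Πx) * sf)       ∎

  scaled-product : ∀ {D P L Π⁻ A A′ f F} → A′ ≈ Π⁻ * L → F ≈ f * P → A ≈ Π⁻ * D →
    D * (A′ * F) ≈ (P * L) * (A * f)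
  scaled-product {D} {P} {L} {Π⁻} {A} {A′} {f} {F} A′≈ F≈ A≈ = begin
    D * (A′ * F)               ≈⟨ *-congˡ (*-cong A′≈ F≈) ⟩
    D * ((Π⁻ * L) * (f * P))   ≈⟨ solve 5 (λ D Π⁻ L f P → D ⊕ ((Π⁻ ⊕ L) ⊕ (f ⊕ P)) ⊜ (P ⊕ L) ⊕ ((Π⁻ ⊕ D) ⊕ f))
      refl D Π⁻ L f P ⟩
    (P * L) * ((Π⁻ * D) * f)   ≈⟨ *-congˡ (*-congʳ (sym A≈)) ⟩
    (P * L) * (A * f)          ∎

  module _ {D E : Carrier} (D-cancel : ∀ h → D * h ≈ 0# → h ≈ 0#) (E-cancel : ∀ h → E * h ≈ 0# → h ≈ 0#)
           {A B A′ B′ : Carrier} (scaled : D * (A′ + - B′) ≈ E * (A + - B)) where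

    private
      x≈y⇒x-y≈0 : ∀ {x y} → x ≈ y → x + - y ≈ 0#
      x≈y⇒x-y≈0 {x} {y} e = trans (+-congʳ e) (-‿inverseʳ y)

      x-y≈0⇒x≈y : ∀ {x y} → x + - y ≈ 0# → x ≈ y
      x-y≈0⇒x≈y {x} {y} e = begin
        x                 ≈⟨ sym (+-identityʳ x) ⟩
        x + 0#            ≈⟨ +-congˡ (sym (-‿inverseˡ y)) ⟩
        x + (- y + y)     ≈⟨ sym (+-assoc x (- y) y) ⟩
        (x + - y) + y     ≈⟨ +-congʳ e ⟩
        0# + y            ≈⟨ +-identityˡ y ⟩
        y                 ∎

    transfer-forward : A ≈ B → A′ ≈ B′
    transfer-forward e = x-y≈0⇒x≈y (D-cancel _ (trans scaled (trans (*-congˡ (x≈y⇒x-y≈0 e)) (zeroʳ E))))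

    transfer-backward : A′ ≈ B′ → A ≈ B
    transfer-backward e = x-y≈0⇒x≈y (E-cancel _ (trans (sym scaled) (trans (*-congˡ (x≈y⇒x-y≈0 e)) (zeroʳ D))))

module SeriesRing {c ℓ} (R : CommutativeRing c ℓ) where

  open import Algebra.Structures using (IsCommutativeRing)
  open import Data.Nat as ℕ using (zero; suc; _∸_)
  open import Data.Product using (_,_)
  open import Relation.Binary.PropositionalEquality as P using (_≡_)
  import Relation.Binary.Reasoning.Setoid as SetR
  open import Defs

  open CommutativeRing R
  open Def R
  module SR = Sums R
  module Q = PowerSeries R
  QR = Q.+ₚ-*ₚ-commutativeRing
  module SQ = Sums QR
  module XQ = PowerSeries QR

  sumℕ≡Σ : ∀ n g → sumℕ n g ≡ SR.Σ n g
  sumℕ≡Σ zero g = P.refl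
  sumℕ≡Σ (suc n) g = P.cong (_+ g n) (sumℕ≡Σ n g)

  ΣQ-pointwise : ∀ n h b → SQ.Σ n h b ≡ SR.Σ n (λ i → h i b)
  ΣQ-pointwise zero h b = P.refl
  ΣQ-pointwise (suc n) h b = P.cong (_+ h n b) (ΣQ-pointwise n h b)

  -- Ser is the ring of power series in x over the power series in q.
  ⊗≈*ₚ : ∀ f g → f ⊗ g ≋ f XQ.*ₚ g
  ⊗≈*ₚ f g a b = trans (reflexive (sumℕ≡Σ (suc a) _))
    (trans (SR.Σ-cong (suc a) (λ i → reflexive (sumℕ≡Σ (suc b) _)))
           (reflexive (P.sym (ΣQ-pointwise (suc a) (λ i → f i Q.*ₚ g (a ∸ i)) b))))

  one≋ : oneS ≋ XQ.1ₚ
  one≋ zero zero = refl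
  one≋ zero (suc b) = refl
  one≋ (suc a) b = refl

  private
    module XR = CommutativeRing XQ.+ₚ-*ₚ-commutativeRing
    module XRR = SetR XR.setoid

  ⊗-cong : ∀ {f f' g g'} → f ≋ f' → g ≋ g' → f ⊗ g ≋ f' ⊗ g'
  ⊗-cong {f} {f'} {g} {g'} e e' a b =
    trans (⊗≈*ₚ f g a b) (trans (XR.*-cong e e' a b) (sym (⊗≈*ₚ f' g' a b)))

  ⊗-assoc : ∀ f g h → (f ⊗ g) ⊗ h ≋ f ⊗ (g ⊗ h)
  ⊗-assoc f g h = begin
    (f ⊗ g) ⊗ h ≈⟨ ⊗≈*ₚ (f ⊗ g) h ⟩
    (f ⊗ g) XQ.*ₚ h ≈⟨ XR.*-congʳ {h} {f ⊗ g} {f XQ.*ₚ g} (⊗≈*ₚ f g) ⟩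
    (f XQ.*ₚ g) XQ.*ₚ h ≈⟨ XR.*-assoc f g h ⟩
    f XQ.*ₚ (g XQ.*ₚ h) ≈⟨ XR.*-congˡ {f} {g XQ.*ₚ h} {g ⊗ h} (XR.sym (⊗≈*ₚ g h)) ⟩
    f XQ.*ₚ (g ⊗ h) ≈⟨ XR.sym (⊗≈*ₚ f (g ⊗ h)) ⟩
    f ⊗ (g ⊗ h) ∎
    where open XRR

  ⊗-identityˡ : ∀ f → oneS ⊗ f ≋ f
  ⊗-identityˡ f = XR.trans (⊗≈*ₚ oneS f) (XR.trans (XR.*-congʳ {f} {oneS} {XQ.1ₚ} one≋) (XR.*-identityˡ f))

  ⊗-comm : ∀ f g → f ⊗ g ≋ g ⊗ f
  ⊗-comm f g = XR.trans (⊗≈*ₚ f g) (XR.trans (XR.*-comm f g) (XR.sym (⊗≈*ₚ g f)))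

  ⊗-distribˡ : ∀ f g h → f ⊗ (g ⊕ h) ≋ (f ⊗ g) ⊕ (f ⊗ h)
  ⊗-distribˡ f g h = XR.trans (⊗≈*ₚ f (g ⊕ h)) (XR.trans (XR.distribˡ f g h)
     (XR.+-cong {f XQ.*ₚ g} {f ⊗ g} {f XQ.*ₚ h} {f ⊗ h} (XR.sym (⊗≈*ₚ f g)) (XR.sym (⊗≈*ₚ f h))))

  ⊕-⊗-isCommutativeRing : IsCommutativeRing _≋_ _⊕_ _⊗_ ⊝_ zeroS oneS
  ⊕-⊗-isCommutativeRing = record
    { isRing = record
      { +-isAbelianGroup = XR.+-isAbelianGroup
      ; *-cong = ⊗-cong
      ; *-assoc = ⊗-assoc
      ; *-identity = ⊗-identityˡ , (λ f → XR.trans (⊗-comm f oneS) (⊗-identityˡ f))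
      ; distrib = ⊗-distribˡ , (λ f g h → XR.trans (⊗-comm (g ⊕ h) f) (XR.trans (⊗-distribˡ f g h)
                   (XR.+-cong {f ⊗ g} {g ⊗ f} {f ⊗ h} {h ⊗ f} (⊗-comm f g) (⊗-comm f h))))
      }
    ; *-comm = ⊗-comm
    }

  SerRing : CommutativeRing c ℓ
  SerRing = record { isCommutativeRing = ⊕-⊗-isCommutativeRing }

module SeriesOperations {c ℓ} (R : CommutativeRing c ℓ) where

  open import Data.Nat as ℕ using (ℕ; zero; suc; _∸_; _<_; _≤_)
  import Data.Nat.Properties as NP
  open import Data.Bool using (true; false; if_then_else_)
  open import Relation.Nullary using (does; ¬_)
  open import Data.Empty using (⊥-elim)
  open import Data.Product using (_,_)
  open import Relation.Binary.PropositionalEquality as P using (_≡_)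
  import Relation.Binary.Reasoning.Setoid as SetR
  open import Defs

  open CommutativeRing R
  open Def R
  open SeriesRing R
  open import Algebra.Properties.Ring ring using (-‿distribˡ-*)
  module S = CommutativeRing SerRing
  module QC = CommutativeRing QR
  module SS = SetR S.setoid
  open import Algebra.Properties.Group QC.+-group using (ε⁻¹≈ε)

  -- Pointwise ≋ does not determine the series involved, so they are passed explicitly.
  ⊗-congˡ : ∀ f {g g'} → g ≋ g' → f ⊗ g ≋ f ⊗ g'
  ⊗-congˡ f {g} {g'} e = S.*-congˡ {f} {g} {g'} e
  ⊗-congʳ : ∀ {f f'} g → f ≋ f' → f ⊗ g ≋ f' ⊗ g
  ⊗-congʳ {f} {f'} g e = S.*-congʳ {g} {f} {f'} e
  ⊕-congˡ : ∀ f {g g'} → g ≋ g' → f ⊕ g ≋ f ⊕ g'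
  ⊕-congˡ f {g} {g'} e = S.+-congˡ {f} {g} {g'} e
  ⊝-cong : ∀ {f f'} → f ≋ f' → ⊝ f ≋ ⊝ f'
  ⊝-cong {f} {f'} e = S.-‿cong {f} {f'} e

  infix 4 _≈Q_
  _≈Q_ : Q.PS → Q.PS → Set ℓ
  _≈Q_ = Q._≈ₚ_

  ι : Q.PS → Ser
  ι s zero = s
  ι s (suc _) = Q.0ₚ

  ι-⊗ : ∀ s g a → (ι s ⊗ g) a ≈Q s Q.*ₚ g a
  ι-⊗ s g a = QC.trans (⊗≈*ₚ (ι s) g a) (SQ.Σ-head-only a z)
    where
    z : ∀ i → 0 < i → i < suc a → (ι s i Q.*ₚ g (a ∸ i)) QC.≈ Q.0ₚ
    z (suc i) _ _ = QC.zeroˡ (g (a ∸ suc i))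

  scal≋ : ∀ k → scal k ≋ ι (Q.const k)
  scal≋ k zero zero = refl
  scal≋ k zero (suc b) = refl
  scal≋ k (suc a) b = refl

  scal-⊗-coeff : ∀ k g a b → (scal k ⊗ g) a b ≈ k * g a b
  scal-⊗-coeff k g a b = trans (⊗-cong {scal k} {ι (Q.const k)} {g} {g} (scal≋ k) (λ _ _ → refl) a b)
    (trans (ι-⊗ (Q.const k) g a b) (Q.const-* k (g a) b))

  monomial≡if : ∀ j b → Q.monomial j b ≡ (if does (b ℕ.≟ j) then 1# else 0#)
  monomial≡if zero zero = P.refl
  monomial≡if zero (suc b) = P.refl
  monomial≡if (suc j) zero = P.refl
  monomial≡if (suc j) (suc b) = monomial≡if j b

  qmono≋ : ∀ j → qmono j ≋ ι (Q.monomial j)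
  qmono≋ j zero b = reflexive (P.sym (monomial≡if j b))
  qmono≋ j (suc a) b = refl

  Lin : Carrier → ℕ → Ser
  Lin k h = oneS ⊖ scal k ⊗ mono 1 h

  mono1-⊗ : ∀ h g → mono 1 h ⊗ g ≋ XQ.shift 1 (λ a → Q.monomial h Q.*ₚ g a)
  mono1-⊗ h g zero b = trans (⊗≈*ₚ (mono 1 h) g 0 b)
    (trans (+-identityˡ _) (SR.Σ-zero (suc b) (λ j _ → zeroˡ _)))
  mono1-⊗ h g (suc a) = QC.trans (⊗≈*ₚ (mono 1 h) g (suc a))
     (QC.trans (SQ.Σ-head (suc a) _)
     (QC.trans (QC.+-cong {x = mono 1 h 0 Q.*ₚ g (suc a)} {y = Q.0ₚ}
       (λ b → SR.Σ-zero (suc b) (λ j _ → zeroˡ _)) (SQ.Σ-head-only a z))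
     (QC.trans (QC.+-identityˡ _) (Q.*ₚ-cong {mono 1 h 1} {Q.monomial h} {g a} {g a}
       (λ b → reflexive (P.sym (monomial≡if h b))) (λ _ → refl)))))
    where
    z : ∀ i → 0 < i → i < suc a → (mono 1 h (suc i) Q.*ₚ g (suc a ∸ suc i)) QC.≈ Q.0ₚ
    z (suc i) _ _ = λ b → SR.Σ-zero (suc b) (λ j _ → zeroˡ _)

  X-⊗ : ∀ g → X ⊗ g ≋ XQ.shift 1 g
  X-⊗ g = S.trans (mono1-⊗ 0 g) (XQ.shift-cong 1 {λ a → Q.monomial 0 Q.*ₚ g a} {g} (λ a → Q.*ₚ-identityˡ (g a)))

  powX-⊗ : ∀ l g → powS X l ⊗ g ≋ XQ.shift l g
  powX-⊗ zero g = ⊗-identityˡ g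
  powX-⊗ (suc l) g = S.trans (⊗-assoc X (powS X l) g)
    (S.trans (X-⊗ (powS X l ⊗ g)) (S.trans (XQ.shift-cong 1 {powS X l ⊗ g} {XQ.shift l g} (powX-⊗ l g))
      (XQ.shift-shift 1 l g)))

  ⊗-1-X : ∀ g → g ⊗ (oneS ⊖ X) ≋ g ⊖ XQ.shift 1 g
  ⊗-1-X g = begin
    g ⊗ (oneS ⊕ ⊝ X) ≈⟨ S.distribˡ g oneS (⊝ X) ⟩
    g ⊗ oneS ⊕ g ⊗ ⊝ X ≈⟨ S.+-cong (S.*-identityʳ g) (S.sym (-‿distribʳ-* g X)) ⟩
    g ⊕ ⊝ (g ⊗ X) ≈⟨ S.+-congˡ (S.-‿cong (S.trans (S.*-comm g X) (X-⊗ g))) ⟩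
    g ⊕ ⊝ XQ.shift 1 g ∎
    where
    open SS
    open import Algebra.Properties.Ring S.ring using (-‿distribʳ-*)

  shift-if : ∀ k s b → Q.shift k s b ≡ (if does (k ℕ.≤? b) then s (b ∸ k) else 0#)
  shift-if zero s b = P.refl
  shift-if (suc k) s zero = P.refl
  shift-if (suc zero) s (suc b) = P.refl
  shift-if (suc (suc k)) s (suc b) = shift-if (suc k) s b

  subst≋ : ∀ f i → subst f i ≋ λ a → Q.shift (i ℕ.* a) (f a)
  subst≋ f i a b = reflexive (P.sym (shift-if (i ℕ.* a) (f a) b))

  module QS = SetR QC.setoid
  open import Algebra.Properties.CommutativeSemigroup QC.*-commutativeSemigroup using () renaming
    (interchange to *-interchangeQ)

  subst-⊗ : ∀ f g i → subst (f ⊗ g) i ≋ subst f i ⊗ subst g i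
  subst-⊗ f g i a = begin
    subst (f ⊗ g) i a ≈⟨ subst≋ (f ⊗ g) i a ⟩
    Q.shift (i ℕ.* a) ((f ⊗ g) a) ≈⟨ Q.shift-cong (i ℕ.* a) {(f ⊗ g) a} {(f XQ.*ₚ g) a} (⊗≈*ₚ f g a) ⟩
    Q.shift (i ℕ.* a) ((f XQ.*ₚ g) a) ≈⟨ QC.sym (Q.monomial-* (i ℕ.* a) _) ⟩
    Q.monomial (i ℕ.* a) Q.*ₚ SQ.Σ (suc a) (λ j → f j Q.*ₚ g (a ∸ j)) ≈⟨ SQ.Σ-*ˡ (suc a) _ _ ⟩
    SQ.Σ (suc a) (λ j → Q.monomial (i ℕ.* a) Q.*ₚ (f j Q.*ₚ g (a ∸ j))) ≈⟨ SQ.Σ-cong< (suc a) term ⟩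
    SQ.Σ (suc a) (λ j → Q.shift (i ℕ.* j) (f j) Q.*ₚ Q.shift (i ℕ.* (a ∸ j)) (g (a ∸ j))) ≈⟨ QC.sym
      (XQ.*ₚ-cong {subst f i} {λ a → Q.shift (i ℕ.* a) (f a)} {subst g i} {λ a → Q.shift (i ℕ.* a) (g a)}
        (subst≋ f i) (subst≋ g i) a) ⟩
    (subst f i XQ.*ₚ subst g i) a ≈⟨ QC.sym (⊗≈*ₚ (subst f i) (subst g i) a) ⟩
    (subst f i ⊗ subst g i) a ∎
    where
    open QS
    term : ∀ j → j < suc a → (Q.monomial (i ℕ.* a) Q.*ₚ (f j Q.*ₚ g (a ∸ j))) QC.≈
      (Q.shift (i ℕ.* j) (f j) Q.*ₚ Q.shift (i ℕ.* (a ∸ j)) (g (a ∸ j)))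
    term j p = begin
      Q.monomial (i ℕ.* a) Q.*ₚ (f j Q.*ₚ g (a ∸ j)) ≈⟨ QC.*-congʳ {f j Q.*ₚ g (a ∸ j)}
        (QC.reflexive (P.cong Q.monomial e)) ⟩
      Q.monomial (i ℕ.* j ℕ.+ i ℕ.* (a ∸ j)) Q.*ₚ (f j Q.*ₚ g (a ∸ j)) ≈⟨ QC.*-congʳ {f j Q.*ₚ g (a ∸ j)}
        (QC.sym (Q.monomial-+ (i ℕ.* j) (i ℕ.* (a ∸ j)))) ⟩
      (Q.monomial (i ℕ.* j) Q.*ₚ Q.monomial (i ℕ.* (a ∸ j))) Q.*ₚ (f j Q.*ₚ g (a ∸ j)) ≈⟨ *-interchangeQ
        (Q.monomial (i ℕ.* j)) (Q.monomial (i ℕ.* (a ∸ j))) (f j) (g (a ∸ j)) ⟩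
      (Q.monomial (i ℕ.* j) Q.*ₚ f j) Q.*ₚ (Q.monomial (i ℕ.* (a ∸ j)) Q.*ₚ g (a ∸ j)) ≈⟨ QC.*-cong
        {Q.monomial (i ℕ.* j) Q.*ₚ f j} {Q.shift (i ℕ.* j) (f j)} {Q.monomial (i ℕ.* (a ∸ j)) Q.*ₚ g (a ∸ j)}
          (Q.monomial-* (i ℕ.* j) (f j)) (Q.monomial-* (i ℕ.* (a ∸ j)) (g (a ∸ j))) ⟩
      Q.shift (i ℕ.* j) (f j) Q.*ₚ Q.shift (i ℕ.* (a ∸ j)) (g (a ∸ j)) ∎
      where
      e : i ℕ.* a ≡ i ℕ.* j ℕ.+ i ℕ.* (a ∸ j)
      e = P.trans (P.cong (i ℕ.*_) (P.sym (NP.m+[n∸m]≡n (NP.≤-pred p)))) (NP.*-distribˡ-+ i j (a ∸ j))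

  subst-cong : ∀ {f g} i → f ≋ g → subst f i ≋ subst g i
  subst-cong {f} {g} i e = S.trans (subst≋ f i)
    (S.trans (λ a → Q.shift-cong (i ℕ.* a) {f a} {g a} (e a)) (S.sym (subst≋ g i)))

  subst-⊕ : ∀ f g i → subst (f ⊕ g) i ≋ subst f i ⊕ subst g i
  subst-⊕ f g i = S.trans (subst≋ (f ⊕ g) i) (S.trans (λ a → Q.shift-+ (i ℕ.* a) (f a) (g a))
     (S.sym (S.+-cong {subst f i} {λ a → Q.shift (i ℕ.* a) (f a)} {subst g i} {λ a → Q.shift (i ℕ.* a) (g a)}
       (subst≋ f i) (subst≋ g i))))

  subst-⊝ : ∀ f i → subst (⊝ f) i ≋ ⊝ subst f i
  subst-⊝ f i = S.trans (subst≋ (⊝ f) i) (S.trans (λ a → Q.shift-neg (i ℕ.* a) (f a))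
     (S.sym (S.-‿cong {subst f i} {λ a → Q.shift (i ℕ.* a) (f a)} (subst≋ f i))))

  subst-ι : ∀ s i → subst (ι s) i ≋ ι s
  subst-ι s i zero = QC.trans (subst≋ (ι s) i 0) (QC.reflexive (P.cong (λ k → Q.shift k s) (NP.*-zeroʳ i)))
  subst-ι s i (suc a) = QC.trans (subst≋ (ι s) i (suc a)) (Q.shift-zero (i ℕ.* suc a))

  oneι : oneS ≋ ι Q.1ₚ
  oneι zero zero = refl
  oneι zero (suc b) = refl
  oneι (suc a) b = refl

  subst-one : ∀ i → subst oneS i ≋ oneS
  subst-one i = S.trans (subst-cong i oneι) (S.trans (subst-ι Q.1ₚ i) (S.sym oneι))

  subst-scal : ∀ k i → subst (scal k) i ≋ scal k
  subst-scal k i = S.trans (subst-cong i (scal≋ k)) (S.trans (subst-ι (Q.const k) i) (S.sym (scal≋ k)))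

  subst-subst : ∀ f i j → subst (subst f i) j ≋ subst f (j ℕ.+ i)
  subst-subst f i j a = begin
    subst (subst f i) j a ≈⟨ subst≋ (subst f i) j a ⟩
    Q.shift (j ℕ.* a) (subst f i a) ≈⟨ Q.shift-cong (j ℕ.* a) {subst f i a} {Q.shift (i ℕ.* a) (f a)}
      (subst≋ f i a) ⟩
    Q.shift (j ℕ.* a) (Q.shift (i ℕ.* a) (f a)) ≈⟨ Q.shift-shift (j ℕ.* a) (i ℕ.* a) (f a) ⟩
    Q.shift (j ℕ.* a ℕ.+ i ℕ.* a) (f a) ≈⟨ QC.reflexive
      (P.cong (λ k → Q.shift k (f a)) (P.sym (NP.*-distribʳ-+ a j i))) ⟩
    Q.shift ((j ℕ.+ i) ℕ.* a) (f a) ≈⟨ QC.sym (subst≋ f (j ℕ.+ i) a) ⟩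
    subst f (j ℕ.+ i) a ∎
    where open QS

  subst-prodS : ∀ n g i → subst (prodS n g) i ≋ prodS n (λ t → subst (g t) i)
  subst-prodS zero g i = subst-one i
  subst-prodS (suc n) g i = S.trans (subst-⊗ (prodS n g) (g n) i)
    (⊗-cong {subst (prodS n g) i} {prodS n (λ t → subst (g t) i)} {subst (g n) i} {subst (g n) i}
      (subst-prodS n g i) S.refl)

  ⊗-x⁰ : ∀ f g → (f ⊗ g) 0 ≈Q f 0 Q.*ₚ g 0
  ⊗-x⁰ f g = QC.trans (⊗≈*ₚ f g 0) (QC.+-identityˡ _)

  XFree : Ser → Set ℓ
  XFree f = ∀ a → f (suc a) ≈Q Q.0ₚ

  XFree-⊗ : ∀ f g → XFree f → XFree g → XFree (f ⊗ g)
  XFree-⊗ f g xf xg a = QC.trans (⊗≈*ₚ f g (suc a)) (SQ.Σ-zero (suc (suc a)) z)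
    where
    z : ∀ i → i < suc (suc a) → (f i Q.*ₚ g (suc a ∸ i)) QC.≈ Q.0ₚ
    z zero _ = QC.trans (QC.*-congˡ {f 0} (xg a)) (QC.zeroʳ (f 0))
    z (suc i) _ = QC.trans (QC.*-congʳ {g (suc a ∸ suc i)} (xf i)) (QC.zeroˡ (g (suc a ∸ suc i)))

  XFree-⊕ : ∀ f g → XFree f → XFree g → XFree (f ⊕ g)
  XFree-⊕ f g xf xg a b = trans (+-cong (xf a b) (xg a b)) (+-identityˡ 0#)

  XFree-⊝ : ∀ f → XFree f → XFree (⊝ f)
  XFree-⊝ f xf a b = trans (-‿cong (xf a b)) (ε⁻¹≈ε b)

  XFree-one : XFree oneS
  XFree-one a b = refl

  XFree-qmono : ∀ j → XFree (qmono j)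
  XFree-qmono j a b = refl

  XFree-geomq : ∀ j → XFree (geomq j)
  XFree-geomq j a b = refl

  XFree-zero : XFree zeroS
  XFree-zero a b = refl

  XFree-prodS : ∀ n g → (∀ t → XFree (g t)) → XFree (prodS n g)
  XFree-prodS zero g x = XFree-one
  XFree-prodS (suc n) g x = XFree-⊗ (prodS n g) (g n) (XFree-prodS n g x) (x n)

  XFree-qbin : ∀ m s → XFree (qbin m s)
  XFree-qbin m s with does (s ℕ.≤? m)
  ... | true = XFree-prodS s (λ t → (oneS ⊖ qmono (m ∸ t)) ⊗ geomq (suc t))
    (λ t → XFree-⊗ (oneS ⊖ qmono (m ∸ t)) (geomq (suc t))
      (XFree-⊕ oneS (⊝ qmono (m ∸ t)) XFree-one (XFree-⊝ (qmono (m ∸ t)) (XFree-qmono (m ∸ t))))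
        (XFree-geomq (suc t)))
  ... | false = XFree-zero

  ⊗-Lin : ∀ g k h → g ⊗ Lin k h ≋ g ⊕ ⊝ (scal k ⊗ (mono 1 h ⊗ g))
  ⊗-Lin g k h = begin
    g ⊗ (oneS ⊕ ⊝ (scal k ⊗ mono 1 h)) ≈⟨ S.distribˡ g oneS (⊝ (scal k ⊗ mono 1 h)) ⟩
    g ⊗ oneS ⊕ g ⊗ ⊝ (scal k ⊗ mono 1 h) ≈⟨ S.+-cong (S.*-identityʳ g)
      (S.sym (-‿distribʳ-*S g (scal k ⊗ mono 1 h))) ⟩
    g ⊕ ⊝ (g ⊗ (scal k ⊗ mono 1 h)) ≈⟨ ⊕-congˡ g
      (⊝-cong (S.trans (S.*-comm g (scal k ⊗ mono 1 h)) (S.*-assoc (scal k) (mono 1 h) g))) ⟩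
    g ⊕ ⊝ (scal k ⊗ (mono 1 h ⊗ g)) ∎
    where
    open SS
    open import Algebra.Properties.Ring S.ring renaming (-‿distribʳ-* to -‿distribʳ-*S)

  scal-⊗ : ∀ k g a → (scal k ⊗ g) a ≈Q Q.const k Q.*ₚ g a
  scal-⊗ k g a = QC.trans (⊗-cong {scal k} {ι (Q.const k)} {g} {g} (scal≋ k) S.refl a) (ι-⊗ (Q.const k) g a)

  ⊗-Lin-x⁰ : ∀ g k h → (g ⊗ Lin k h) 0 ≈Q g 0
  ⊗-Lin-x⁰ g k h = QC.trans (⊗-Lin g k h 0) (QC.trans (QC.+-congˡ {g 0}
     (QC.trans (QC.-‿cong {(scal k ⊗ (mono 1 h ⊗ g)) 0} {Q.0ₚ}
       (QC.trans (scal-⊗ k (mono 1 h ⊗ g) 0) (QC.trans (QC.*-congˡ {Q.const k} (mono1-⊗ h g 0))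
         (QC.zeroʳ (Q.const k)))))
       (λ b → ε⁻¹≈ε b))) (QC.+-identityʳ (g 0)))

  ⊗-Lin-x^suc : ∀ g k h a → (g ⊗ Lin k h) (suc a) ≈Q g (suc a) Q.+ₚ Q.-ₚ
    (Q.const k Q.*ₚ (Q.monomial h Q.*ₚ g a))
  ⊗-Lin-x^suc g k h a = QC.trans (⊗-Lin g k h (suc a)) (QC.+-congˡ {g (suc a)}
     (QC.-‿cong {(scal k ⊗ (mono 1 h ⊗ g)) (suc a)} {Q.const k Q.*ₚ (Q.monomial h Q.*ₚ g a)}
       (QC.trans (scal-⊗ k (mono 1 h ⊗ g) (suc a)) (QC.*-congˡ {Q.const k} (mono1-⊗ h g (suc a))))))

  sumS≈ : ∀ lo hi g a → sumS lo hi g a ≈Q SQ.Σ (suc hi ∸ lo) (λ j → g (lo ℕ.+ j) a)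
  sumS≈ lo hi g a b = trans (reflexive (sumℕ≡Σ (suc hi ∸ lo) _))
    (reflexive (P.sym (ΣQ-pointwise (suc hi ∸ lo) (λ j → g (lo ℕ.+ j) a) b)))

  shift-XFree-at : ∀ k Y → XQ.shift k Y k ≡ Y 0
  shift-XFree-at zero Y = P.refl
  shift-XFree-at (suc k) Y = shift-XFree-at k Y

  shift-XFree-off : ∀ k Y → XFree Y → ∀ a → ¬ (a ≡ k) → XQ.shift k Y a ≈Q Q.0ₚ
  shift-XFree-off zero Y x zero ne = ⊥-elim (ne P.refl)
  shift-XFree-off zero Y x (suc a) ne = x a
  shift-XFree-off (suc k) Y x zero ne = QC.refl
  shift-XFree-off (suc k) Y x (suc a) ne = shift-XFree-off k Y x a (λ e → ne (P.cong suc e))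

  scal-cong : ∀ {a b} → a ≈ b → scal a ≋ scal b
  scal-cong {a} {b} e = S.trans (scal≋ a) (S.trans (λ n → ιc n) (S.sym (scal≋ b)))
    where
    ιc : ∀ n → ι (Q.const a) n ≈Q ι (Q.const b) n
    ιc zero = Q.const-cong e
    ιc (suc n) = QC.refl

  ι-cong : ∀ {s t} → s ≈Q t → ι s ≋ ι t
  ι-cong e zero = e
  ι-cong e (suc n) = QC.refl

  scal-one : scal 1# ≋ oneS
  scal-one = S.trans (scal≋ 1#) (S.trans (ι-cong Q.const-1) (S.sym oneι))

  scal-neg : ∀ a → scal (- a) ≋ ⊝ scal a
  scal-neg a = S.trans (scal≋ (- a)) (S.trans (λ n → h n) (⊝-cong (S.sym (scal≋ a))))
    where
    h : ∀ n → ι (Q.const (- a)) n ≈Q (⊝ ι (Q.const a)) n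
    h zero = Q.const-neg a
    h (suc n) b = sym (ε⁻¹≈ε b)

  XFree-scal : ∀ k → XFree (scal k)
  XFree-scal k a b = refl

  powS-negX : ∀ k → powS negX k ≋ scal (powR (- 1#) k) ⊗ powS X k
  powS-negX zero = S.sym (S.trans (⊗-congʳ oneS scal-one) (S.*-identityˡ oneS))
  powS-negX (suc k) = begin
    negX ⊗ powS negX k ≈⟨ ⊗-congˡ negX (powS-negX k) ⟩
    (⊝ X) ⊗ (scal σ ⊗ powS X k) ≈⟨ S.sym (-‿distribˡ-*S X (scal σ ⊗ powS X k)) ⟩
    ⊝ (X ⊗ (scal σ ⊗ powS X k)) ≈⟨ ⊝-cong (x∙yz≈y∙xzS X (scal σ) (powS X k)) ⟩
    ⊝ (scal σ ⊗ (X ⊗ powS X k)) ≈⟨ -‿distribˡ-*S (scal σ) (powS X (suc k)) ⟩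
    (⊝ scal σ) ⊗ powS X (suc k) ≈⟨ ⊗-congʳ (powS X (suc k))
      (S.sym (S.trans (scal-cong (trans (sym (-‿distribˡ-* 1# σ)) (-‿cong (*-identityˡ σ)))) (scal-neg σ))) ⟩
    scal (- 1# * σ) ⊗ powS X (suc k) ∎
    where
    open SS
    σ : Carrier
    σ = powR (- 1#) k
    open import Algebra.Properties.Ring S.ring renaming (-‿distribˡ-* to -‿distribˡ-*S)
    open import Algebra.Properties.CommutativeSemigroup S.*-commutativeSemigroup renaming
      (x∙yz≈y∙xz to x∙yz≈y∙xzS)

  powS-negX-⊗ : ∀ k Z → powS negX k ⊗ Z ≋ XQ.shift k (scal (powR (- 1#) k) ⊗ Z)
  powS-negX-⊗ k Z = S.trans (⊗-congʳ Z (powS-negX k))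
    (S.trans (S.trans (⊗-congʳ Z (S.*-comm (scal (powR (- 1#) k)) (powS X k)))
      (S.*-assoc (powS X k) (scal (powR (- 1#) k)) Z)) (powX-⊗ k _))

  XFree-scal-⊗ : ∀ k Z → XFree Z → XFree (scal k ⊗ Z)
  XFree-scal-⊗ k Z x = XFree-⊗ (scal k) Z (XFree-scal k) x

  module ΣS = Sums SerRing

  ΣS-pointwise : ∀ n (h : ℕ → Ser) a b → ΣS.Σ n h a b ≡ SR.Σ n (λ j → h j a b)
  ΣS-pointwise zero h a b = P.refl
  ΣS-pointwise (suc n) h a b = P.cong (_+ h n a b) (ΣS-pointwise n h a b)

  sumS≋ : ∀ lo hi g → sumS lo hi g ≋ ΣS.Σ (suc hi ∸ lo) (λ j → g (lo ℕ.+ j))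
  sumS≋ lo hi g a b = trans (reflexive (sumℕ≡Σ (suc hi ∸ lo) _))
    (reflexive (P.sym (ΣS-pointwise (suc hi ∸ lo) (λ j → g (lo ℕ.+ j)) a b)))

  sumS-⊗ʳ : ∀ lo hi g h → sumS lo hi g ⊗ h ≋ sumS lo hi (λ j → g j ⊗ h)
  sumS-⊗ʳ lo hi g h = S.trans (⊗-congʳ h (sumS≋ lo hi g))
    (S.trans (ΣS.Σ-*ʳ (suc hi ∸ lo) h (λ j → g (lo ℕ.+ j))) (S.sym (sumS≋ lo hi (λ j → g j ⊗ h))))

  sumS-⊗ˡ : ∀ lo hi g h → h ⊗ sumS lo hi g ≋ sumS lo hi (λ j → h ⊗ g j)
  sumS-⊗ˡ lo hi g h = S.trans (⊗-congˡ h (sumS≋ lo hi g))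
    (S.trans (ΣS.Σ-*ˡ (suc hi ∸ lo) h (λ j → g (lo ℕ.+ j))) (S.sym (sumS≋ lo hi (λ j → h ⊗ g j))))

  sumS-cong : ∀ lo hi {g h} → (∀ j → j < suc hi ∸ lo → g (lo ℕ.+ j) ≋ h (lo ℕ.+ j)) →
    sumS lo hi g ≋ sumS lo hi h
  sumS-cong lo hi {g} {h} e = S.trans (sumS≋ lo hi g)
    (S.trans (ΣS.Σ-cong< (suc hi ∸ lo) e) (S.sym (sumS≋ lo hi h)))

  ⊗-cancel-unit : ∀ g → g 0 ≈Q Q.1ₚ → ∀ h → g ⊗ h ≋ zeroS → h ≋ zeroS
  ⊗-cancel-unit g g0 h e = XQ.*ₚ-cancel-unit g h g0 (λ a → QC.trans (QC.sym (⊗≈*ₚ g h a)) (e a))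

  Lin-x⁰ : ∀ k h → Lin k h 0 ≈Q Q.1ₚ
  Lin-x⁰ k h b = trans (+-congˡ (trans (-‿cong (trans (scal-⊗-coeff k (mono 1 h) 0 b) (zeroʳ _))) (ε⁻¹≈ε b)))
    (trans (+-identityʳ _) (oneι 0 b))

  1-X-x⁰ : (oneS ⊖ X) 0 ≈Q Q.1ₚ
  1-X-x⁰ b = trans (+-congˡ (ε⁻¹≈ε b)) (trans (+-identityʳ _) (oneι 0 b))

  AtZeroOne-resp : ∀ {f g} → f 0 ≈Q g 0 → AtZeroOne f → AtZeroOne g
  AtZeroOne-resp f≈g (f00 , f0s) = trans (sym (f≈g 0)) f00 , λ b → trans (sym (f≈g (suc b))) (f0s b)

  sumS-cong₁ : ∀ n {g h} → (∀ i → suc i ≤ n → g (suc i) ≋ h (suc i)) → sumS 1 n g ≋ sumS 1 n h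
  sumS-cong₁ n {g} {h} e = sumS-cong 1 n {g} {h} (λ j p → e j p)

module InfiniteProduct {c ℓ} (R : CommutativeRing c ℓ) where

  open import Data.Nat as ℕ using (ℕ; zero; suc; _∸_; _<_; _≤_; s≤s)
  import Data.Nat.Properties as NP
  open import Data.Bool using (true; false; if_then_else_)
  open import Relation.Nullary using (does; yes; no; ¬_)
  open import Relation.Nullary.Decidable using (dec-false)
  open import Relation.Binary.PropositionalEquality as P using (_≡_)
  import Relation.Binary.Reasoning.Setoid as SetR
  open import Defs

  open CommutativeRing R
  open Def R
  open SeriesRing R
  open SeriesOperations R

  infix 4 _~[_]_
  _~[_]_ : Ser → ℕ → Ser → Set ℓ
  f ~[ b ] g = ∀ a b' → b' ≤ b → f a b' ≈ g a b'

  ≋⇒~ : ∀ {f g} b → f ≋ g → f ~[ b ] g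
  ≋⇒~ b e a b' _ = e a b'

  ~-sym : ∀ {f g b} → f ~[ b ] g → g ~[ b ] f
  ~-sym e a b' p = sym (e a b' p)

  ~-trans : ∀ {f g h b} → f ~[ b ] g → g ~[ b ] h → f ~[ b ] h
  ~-trans e e' a b' p = trans (e a b' p) (e' a b' p)

  ~-mono : ∀ {f g n m} → n ≤ m → f ~[ m ] g → f ~[ n ] g
  ~-mono q e a b' p = e a b' (NP.≤-trans p q)

  ⊗-~ : ∀ {f f' g g' b} → f ~[ b ] f' → g ~[ b ] g' → f ⊗ g ~[ b ] f' ⊗ g'
  ⊗-~ {f} {f'} {g} {g'} {b} e e' a b' q =
    trans (reflexive (sumℕ≡Σ (suc a) _))
    (trans (SR.Σ-cong (suc a) (λ i → trans (reflexive (sumℕ≡Σ (suc b') _))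
       (trans (SR.Σ-cong< (suc b') (λ j p → *-cong (e i j (NP.≤-trans (NP.≤-pred p) q))
                                                  (e' (a ∸ i) (b' ∸ j) (NP.≤-trans (NP.m∸n≤m b' j) q))))
              (sym (reflexive (sumℕ≡Σ (suc b') _))))))
       (sym (reflexive (sumℕ≡Σ (suc a) _))))

  subst-~ : ∀ {f g b} i → f ~[ b ] g → subst f i ~[ b ] subst g i
  subst-~ {f} {g} {b} i e a b' q with does (i ℕ.* a ℕ.≤? b')
  ... | true = e a (b' ∸ i ℕ.* a) (NP.≤-trans (NP.m∸n≤m b' (i ℕ.* a)) q)
  ... | false = refl

  mono-off : ∀ i j a b → ¬ (b ≡ j) → mono i j a b ≡ 0#
  mono-off i j a b ne rewrite dec-false (b ℕ.≟ j) ne with does (a ℕ.≟ i)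
  ... | true = P.refl
  ... | false = P.refl

  prodS-head : ∀ n g → prodS (suc n) g ≋ g 0 ⊗ prodS n (λ t → g (suc t))
  prodS-head zero g = S.*-comm oneS (g 0)
  prodS-head (suc n) g = S.trans (⊗-cong {prodS (suc n) g} {g 0 ⊗ prodS n (λ t → g (suc t))} {g (suc n)}
    {g (suc n)} (prodS-head n g) S.refl)
                             (S.*-assoc (g 0) (prodS n (λ t → g (suc t))) (g (suc n)))

  prodFT-head : ∀ n g → prodS (suc n) g ≋ g 0 ⊗ prodFT 1 n g
  prodFT-head = prodS-head

  does-sym : ∀ m n → does (m ℕ.≟ n) ≡ does (n ℕ.≟ m)
  does-sym m n with m ℕ.≟ n
  ... | yes e rewrite e = P.refl
  ... | no ne = P.trans (dec-false (m ℕ.≟ n) ne) (P.sym (dec-false (n ℕ.≟ m) (λ e → ne (P.sym e))))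

  geomx-qm : ∀ n a b → geomx n a b ≡ Q.monomial (n ℕ.* a) b
  geomx-qm n a b = P.trans (P.cong (λ t → if t then 1# else 0#) (does-sym (n ℕ.* a) b))
    (P.sym (monomial≡if (n ℕ.* a) b))

  subst-geomx : ∀ n → subst (geomx n) 1 ≋ geomx (suc n)
  subst-geomx n a = begin
    subst (geomx n) 1 a ≈⟨ subst≋ (geomx n) 1 a ⟩
    Q.shift (1 ℕ.* a) (geomx n a) ≈⟨ Q.shift-cong (1 ℕ.* a) {geomx n a} {Q.monomial (n ℕ.* a)}
      (λ b → reflexive (geomx-qm n a b)) ⟩
    Q.shift (1 ℕ.* a) (Q.monomial (n ℕ.* a)) ≈⟨ Q.shift-monomial (1 ℕ.* a) (n ℕ.* a) ⟩
    Q.monomial (1 ℕ.* a ℕ.+ n ℕ.* a) ≈⟨ QC.reflexive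
      (P.cong (λ t → Q.monomial (t ℕ.+ n ℕ.* a)) (NP.*-identityˡ a)) ⟩
    Q.monomial (suc n ℕ.* a) ≈⟨ (λ b → reflexive (P.sym (geomx-qm (suc n) a b))) ⟩
    geomx (suc n) a ∎
    where open QS

  subst-mono1 : ∀ h k → subst (mono 1 h) k ≋ mono 1 (k ℕ.+ h)
  subst-mono1 h k zero = QC.trans (subst≋ (mono 1 h) k 0) (Q.shift-zero (k ℕ.* 0))
  subst-mono1 h k (suc zero) = begin
    subst (mono 1 h) k 1 ≈⟨ subst≋ (mono 1 h) k 1 ⟩
    Q.shift (k ℕ.* 1) (mono 1 h 1) ≈⟨ Q.shift-cong (k ℕ.* 1) {mono 1 h 1} {Q.monomial h}
      (λ b → reflexive (P.sym (monomial≡if h b))) ⟩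
    Q.shift (k ℕ.* 1) (Q.monomial h) ≈⟨ Q.shift-monomial (k ℕ.* 1) h ⟩
    Q.monomial (k ℕ.* 1 ℕ.+ h) ≈⟨ QC.reflexive (P.cong (λ t → Q.monomial (t ℕ.+ h)) (NP.*-identityʳ k)) ⟩
    Q.monomial (k ℕ.+ h) ≈⟨ (λ b → reflexive (monomial≡if (k ℕ.+ h) b)) ⟩
    mono 1 (k ℕ.+ h) 1 ∎
    where open QS
  subst-mono1 h k (suc (suc a)) = QC.trans (subst≋ (mono 1 h) k (suc (suc a)))
    (Q.shift-zero (k ℕ.* suc (suc a)))

  Lin≈1 : ∀ k m → Lin k (suc m) ~[ m ] oneS
  Lin≈1 k m a b' p = trans (+-congˡ (-‿cong (trans (scal-⊗-coeff k (mono 1 (suc m)) a b')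
      (trans (*-congˡ (reflexive (mono-off 1 (suc m) a b' (λ e → NP.<⇒≢ (s≤s p) e)))) (zeroʳ k)))))
      (trans (+-congˡ ε⁻¹≈ε) (+-identityʳ _))
    where open import Algebra.Properties.Group +-group using (ε⁻¹≈ε)

  suc*suc≢ : ∀ m a b' → b' ≤ m → ¬ (suc m ℕ.* suc a ≡ b')
  suc*suc≢ m a b' p e = NP.<⇒≢ (NP.≤-trans (s≤s p)
    (NP.≤-trans (NP.m≤m*n (suc m) (suc a)) (NP.≤-reflexive e))) P.refl

  geomx≈1 : ∀ m → geomx (suc m) ~[ m ] oneS
  geomx≈1 m zero b' p rewrite NP.*-zeroʳ m with b'
  ... | zero = refl
  ... | suc _ = refl
  geomx≈1 m (suc a) b' p rewrite dec-false (suc m ℕ.* suc a ℕ.≟ b') (suc*suc≢ m a b' p) = refl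

  subst-Lin : ∀ k t i → subst (Lin k t) i ≋ Lin k (i ℕ.+ t)
  subst-Lin k t i = begin
    subst (oneS ⊕ ⊝ (scal k ⊗ mono 1 t)) i ≈⟨ subst-⊕ oneS (⊝ (scal k ⊗ mono 1 t)) i ⟩
    subst oneS i ⊕ subst (⊝ (scal k ⊗ mono 1 t)) i ≈⟨ S.+-cong (subst-one i) (subst-⊝ (scal k ⊗ mono 1 t) i) ⟩
    oneS ⊕ ⊝ subst (scal k ⊗ mono 1 t) i ≈⟨ S.+-congˡ (S.-‿cong (subst-⊗ (scal k) (mono 1 t) i)) ⟩
    oneS ⊕ ⊝ (subst (scal k) i ⊗ subst (mono 1 t) i) ≈⟨ S.+-congˡ
      (S.-‿cong (S.*-cong (subst-scal k i) (subst-mono1 t i))) ⟩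
    oneS ⊕ ⊝ (scal k ⊗ mono 1 (i ℕ.+ t)) ∎
    where open SS

  subst-1-mono : ∀ t i → subst (oneS ⊖ mono 1 t) i ≋ oneS ⊖ mono 1 (i ℕ.+ t)
  subst-1-mono t i = begin
    subst (oneS ⊕ ⊝ mono 1 t) i ≈⟨ subst-⊕ oneS (⊝ mono 1 t) i ⟩
    subst oneS i ⊕ subst (⊝ mono 1 t) i ≈⟨ S.+-cong (subst-one i) (subst-⊝ (mono 1 t) i) ⟩
    oneS ⊕ ⊝ subst (mono 1 t) i ≈⟨ S.+-congˡ (S.-‿cong (subst-mono1 t i)) ⟩
    oneS ⊕ ⊝ mono 1 (i ℕ.+ t) ∎
    where open SS

  geomx0≈1 : ∀ a → geomx 0 a ≈Q Q.1ₚ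
  geomx0≈1 a zero = refl
  geomx0≈1 a (suc b) = refl

  geomx0-inverse : geomx 0 ⊗ (oneS ⊖ X) ≋ oneS
  geomx0-inverse = S.trans (⊗-1-X (geomx 0)) pt
    where
    pt : geomx 0 ⊖ XQ.shift 1 (geomx 0) ≋ oneS
    pt zero b = trans (+-congˡ (-‿cong (refl {0#})))
      (trans (+-congˡ ε⁻¹≈ε) (trans (+-identityʳ _) (trans (geomx0≈1 0 b) (S.sym oneι 0 b))))
      where open import Algebra.Properties.Group +-group using (ε⁻¹≈ε)
    pt (suc a) b = trans (+-cong (geomx0≈1 (suc a) b) (-‿cong (geomx0≈1 a b)))
      (trans (-‿inverseʳ _) (S.sym oneι (suc a) b))

  prodS-cong : ∀ n {g h} → (∀ t → t < n → g t ≋ h t) → prodS n g ≋ prodS n h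
  prodS-cong zero e = S.refl
  prodS-cong (suc n) {g} {h} e = S.*-cong {prodS n g} {prodS n h} {g n} {h n}
    (prodS-cong n (λ t p → e t (NP.m<n⇒m<1+n p))) (e n (NP.n<1+n n))

  subst-0 : ∀ f → subst f 0 ≋ f
  subst-0 f = subst≋ f 0

  module Product (z : Carrier) where
    ratio : ℕ → Ser
    ratio n = Lin z n ⊗ geomx n

    -- Params.Pinf is P∞ with z = d * ur.
    P∞ : Ser
    P∞ a b = prodS (suc b) ratio a b

    subst-ratio : ∀ t → subst (ratio t) 1 ≋ ratio (suc t)
    subst-ratio t = begin
      subst (Lin z t ⊗ geomx t) 1 ≈⟨ subst-⊗ (Lin z t) (geomx t) 1 ⟩
      subst (Lin z t) 1 ⊗ subst (geomx t) 1 ≈⟨ S.*-cong (subst-Lin z t 1) (subst-geomx t) ⟩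
      Lin z (suc t) ⊗ geomx (suc t) ∎
      where open SS

    ratio≈1 : ∀ m → ratio (suc m) ~[ m ] oneS
    ratio≈1 m = ~-trans (⊗-~ {b = m} (Lin≈1 z m) (geomx≈1 m)) (≋⇒~ m (⊗-identityˡ oneS))

    partial : ℕ → Ser
    partial n = prodS (suc n) ratio

    partial-step : ∀ n → partial (suc n) ~[ n ] partial n
    partial-step n = ~-trans (⊗-~ {partial n} {partial n} {ratio (suc n)} {oneS} {n} (λ _ _ _ → refl)
      (ratio≈1 n))
                       (≋⇒~ n (S.*-identityʳ (partial n)))

    partial-stable : ∀ n k → partial (k ℕ.+ n) ~[ n ] partial n
    partial-stable n zero = λ _ _ _ → refl
    partial-stable n (suc k) = ~-trans (~-mono (NP.m≤n+m n k) (partial-step (k ℕ.+ n))) (partial-stable n k)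

    P∞≈partial : ∀ b → P∞ ~[ b ] partial b
    P∞≈partial b a b' p = sym (reindexed (partial-stable b' (b ∸ b')) a b' NP.≤-refl)
      where
      reindexed : partial (b ∸ b' ℕ.+ b') ~[ b' ] partial b' → partial b ~[ b' ] partial b'
      reindexed e rewrite NP.m∸n+n≡m p = e

    partial-functional-eq : ∀ b → partial (suc b) ⊗ (oneS ⊖ X) ≋ Lin z 0 ⊗ subst (partial b) 1
    partial-functional-eq b = begin
      partial (suc b) ⊗ L1 ≈⟨ ⊗-congʳ L1 (prodS-head (suc b) ratio) ⟩
      (ratio 0 ⊗ prodS (suc b) (λ t → ratio (suc t))) ⊗ L1
        ≈⟨ ⊗-congʳ L1 (⊗-congˡ (ratio 0) (prodS-cong (suc b) (λ t _ → S.sym (subst-ratio t)))) ⟩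
      (ratio 0 ⊗ prodS (suc b) (λ t → subst (ratio t) 1)) ⊗ L1
        ≈⟨ ⊗-congʳ L1 (⊗-congˡ (ratio 0) (S.sym (subst-prodS (suc b) ratio 1))) ⟩
      ((A ⊗ G) ⊗ W) ⊗ L1 ≈⟨ S.*-assoc (A ⊗ G) W L1 ⟩
      (A ⊗ G) ⊗ (W ⊗ L1) ≈⟨ S.*-assoc A G (W ⊗ L1) ⟩
      A ⊗ (G ⊗ (W ⊗ L1)) ≈⟨ ⊗-congˡ A (⊗-congˡ G (S.*-comm W L1)) ⟩
      A ⊗ (G ⊗ (L1 ⊗ W)) ≈⟨ ⊗-congˡ A (S.sym (S.*-assoc G L1 W)) ⟩
      A ⊗ ((G ⊗ L1) ⊗ W) ≈⟨ ⊗-congˡ A (⊗-congʳ W geomx0-inverse) ⟩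
      A ⊗ (oneS ⊗ W) ≈⟨ ⊗-congˡ A (S.*-identityˡ W) ⟩
      A ⊗ W ∎
      where
      open SS
      L1 A G W : Ser
      L1 = oneS ⊖ X
      A = Lin z 0
      G = geomx 0
      W = subst (partial b) 1

    P∞-functional-eq : P∞ ⊗ (oneS ⊖ X) ≋ Lin z 0 ⊗ subst P∞ 1
    P∞-functional-eq a b =
      trans (⊗-~ {P∞} {partial b} {oneS ⊖ X} {oneS ⊖ X} {b} (P∞≈partial b) (λ _ _ _ → refl) a b NP.≤-refl)
      (trans (⊗-~ {partial b} {partial (suc b)} {oneS ⊖ X} {oneS ⊖ X} {b} (~-sym (partial-step b))
        (λ _ _ _ → refl) a b NP.≤-refl)
      (trans (partial-functional-eq b a b)
      (⊗-~ {Lin z 0} {Lin z 0} {subst (partial b) 1} {subst P∞ 1} {b} (λ _ _ _ → refl)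
        (subst-~ 1 (~-sym (P∞≈partial b))) a b NP.≤-refl)))

    P∞-functional-eq-iterated : ∀ i → P∞ ⊗ prodS i (λ h → oneS ⊖ mono 1 h) ≋ prodS i (λ h → Lin z h) ⊗
      subst P∞ i
    P∞-functional-eq-iterated zero = S.trans (S.*-identityʳ P∞)
      (S.trans (S.sym (subst-0 P∞)) (S.sym (S.*-identityˡ (subst P∞ 0))))
    P∞-functional-eq-iterated (suc i) = begin
      P∞ ⊗ (Πx ⊗ Lx) ≈⟨ S.sym (S.*-assoc P∞ Πx Lx) ⟩
      (P∞ ⊗ Πx) ⊗ Lx ≈⟨ ⊗-congʳ Lx (P∞-functional-eq-iterated i) ⟩
      (ΠL ⊗ subst P∞ i) ⊗ Lx ≈⟨ S.*-assoc ΠL (subst P∞ i) Lx ⟩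
      ΠL ⊗ (subst P∞ i ⊗ Lx) ≈⟨ ⊗-congˡ ΠL (⊗-congˡ (subst P∞ i)
        (S.sym (S.trans (subst-1-mono 0 i) (λ a b → reflexive
          (P.cong (λ t → (oneS ⊖ mono 1 t) a b) (NP.+-identityʳ i)))))) ⟩
      ΠL ⊗ (subst P∞ i ⊗ subst (oneS ⊖ X) i) ≈⟨ ⊗-congˡ ΠL (S.sym (subst-⊗ P∞ (oneS ⊖ X) i)) ⟩
      ΠL ⊗ subst (P∞ ⊗ (oneS ⊖ X)) i ≈⟨ ⊗-congˡ ΠL (subst-cong i P∞-functional-eq) ⟩
      ΠL ⊗ subst (Lin z 0 ⊗ subst P∞ 1) i ≈⟨ ⊗-congˡ ΠL (subst-⊗ (Lin z 0) (subst P∞ 1) i) ⟩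
      ΠL ⊗ (subst (Lin z 0) i ⊗ subst (subst P∞ 1) i) ≈⟨ ⊗-congˡ ΠL
        (⊗-cong (subst-Lin z 0 i) (subst-subst P∞ 1 i)) ⟩
      ΠL ⊗ (Lin z (i ℕ.+ 0) ⊗ subst P∞ (i ℕ.+ 1)) ≈⟨
        (λ a b → reflexive (P.cong₂ (λ t t' → (ΠL ⊗ (Lin z t ⊗ subst P∞ t')) a b) (NP.+-identityʳ i)
          (NP.+-comm i 1))) ⟩
      ΠL ⊗ (Lin z i ⊗ subst P∞ (suc i)) ≈⟨ S.sym (S.*-assoc ΠL (Lin z i) (subst P∞ (suc i))) ⟩
      (ΠL ⊗ Lin z i) ⊗ subst P∞ (suc i) ∎
      where
      open SS
      Πx Lx ΠL : Ser
      Πx = prodS i (λ h → oneS ⊖ mono 1 h)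
      Lx = oneS ⊖ mono 1 i
      ΠL = prodS i (λ h → Lin z h)

    ratio-x⁰ : ∀ n → ratio n 0 ≈Q Q.1ₚ
    ratio-x⁰ n = QC.trans (⊗-x⁰ (Lin z n) (geomx n))
      (QC.trans (QC.*-cong {Lin z n 0} {Q.1ₚ} {geomx n 0} {Q.1ₚ} (Lin-x⁰ z n) geomx-x⁰) (QC.*-identityˡ Q.1ₚ))
      where
      geomx-x⁰ : geomx n 0 ≈Q Q.1ₚ
      geomx-x⁰ b rewrite NP.*-zeroʳ n with b
      ... | zero = refl
      ... | suc _ = refl

    partial-x⁰ : ∀ n → prodS n ratio 0 ≈Q Q.1ₚ
    partial-x⁰ zero = oneι 0
    partial-x⁰ (suc n) = QC.trans (⊗-x⁰ (prodS n ratio) (ratio n))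
      (QC.trans (QC.*-cong {prodS n ratio 0} {Q.1ₚ} {ratio n 0} {Q.1ₚ} (partial-x⁰ n) (ratio-x⁰ n))
        (QC.*-identityˡ Q.1ₚ))

    P∞-x⁰ : P∞ 0 ≈Q Q.1ₚ
    P∞-x⁰ b = partial-x⁰ (suc b) b

module QBinomial {c ℓ} (R : CommutativeRing c ℓ) where

  open import Data.Nat as ℕ using (ℕ; zero; suc; _∸_; _<_; _≤_; z≤n; s≤s)
  import Data.Nat.Properties as NP
  open import Data.Nat.Divisibility using (_∣_; _∣?_; ∣⇒≤; ∣m+n∣m⇒∣n; ∣m∸n∣n⇒∣m; n∣n; _∣0; divides-refl)
  open import Data.Nat.DivMod using (_/_; +-distrib-/-∣ʳ; m*n/n≡m)
  open import Data.Nat.Solver using (module +-*-Solver)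
  open +-*-Solver using (solve; _:+_; _:*_; _:=_; con)
  open import Data.Bool using (Bool; true; false; if_then_else_)
  open import Data.Empty using (⊥-elim)
  open import Relation.Nullary using (does; yes; no; ¬_)
  open import Relation.Nullary.Decidable using (dec-false; dec-true)
  open import Relation.Binary.PropositionalEquality as P using (_≡_)
  import Relation.Binary.Reasoning.Setoid as SetR
  open import Defs

  open CommutativeRing R
  open Def R
  open SeriesRing R
  open SeriesOperations R
  open InfiniteProduct R
  open import Algebra.Properties.Ring QC.ring using (-‿distribʳ-*; -‿distribˡ-*)
  open import Algebra.Properties.Group QC.+-group using (ε⁻¹≈ε)

  prodS-x⁰ : ∀ n g → prodS n g 0 ≈Q SQ.Π n (λ t → g t 0)
  prodS-x⁰ zero g = oneι 0
  prodS-x⁰ (suc n) g = QC.trans (⊗-x⁰ (prodS n g) (g n)) (QC.*-congʳ {g n 0} (prodS-x⁰ n g))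

  gauss : ℕ → ℕ → Q.PS
  gauss m s = qbin m s 0

  geometric : ℕ → Q.PS
  geometric k = geomq k 0

  gaussNumerator : ℕ → ℕ → Q.PS
  gaussNumerator m s = SQ.Π s (λ t → Q.1ₚ Q.+ₚ Q.-ₚ Q.monomial (m ∸ t))

  gaussDenominator⁻¹ : ℕ → Q.PS
  gaussDenominator⁻¹ s = SQ.Π s (λ t → geometric (suc t))

  ≤ᵇ-true : ∀ {s m} → s ≤ m → (s ℕ.≤ᵇ m) ≡ true
  ≤ᵇ-true {s} {m} p = dec-true (s ℕ.≤? m) p

  ≤ᵇ-false : ∀ {s m} → ¬ (s ≤ m) → (s ℕ.≤ᵇ m) ≡ false
  ≤ᵇ-false {s} {m} p = dec-false (s ℕ.≤? m) p

  gauss≈numerator*denominator⁻¹ : ∀ m s → gauss m s ≈Q gaussNumerator m s Q.*ₚ gaussDenominator⁻¹ s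
  gauss≈numerator*denominator⁻¹ m s with s ℕ.≤? m
  ... | yes p rewrite ≤ᵇ-true p = QC.trans (prodS-x⁰ s _) (QC.trans (SQ.Π-cong s fac) (SQ.Π-* s _ _))
    where
    fac : ∀ t → ((oneS ⊖ qmono (m ∸ t)) ⊗ geomq (suc t)) 0 QC.≈
      ((Q.1ₚ Q.+ₚ Q.-ₚ Q.monomial (m ∸ t)) Q.*ₚ geometric (suc t))
    fac t = QC.trans (⊗-x⁰ (oneS ⊖ qmono (m ∸ t)) (geomq (suc t)))
       (QC.*-congʳ {geometric (suc t)} (QC.+-cong {oneS 0} {Q.1ₚ} {(⊝ qmono (m ∸ t)) 0} (oneι 0)
         (QC.-‿cong {qmono (m ∸ t) 0} {Q.monomial (m ∸ t)} (qmono≋ (m ∸ t) 0))))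
  ... | no np rewrite ≤ᵇ-false np = QC.sym
    (QC.trans (QC.*-congʳ {gaussDenominator⁻¹ s} (SQ.Π-zero s m _ (NP.≰⇒> np) z))
      (QC.zeroˡ (gaussDenominator⁻¹ s)))
    where
    z : (Q.1ₚ Q.+ₚ Q.-ₚ Q.monomial (m ∸ m)) QC.≈ Q.0ₚ
    z rewrite NP.n∸n≡0 m = QC.-‿inverseʳ Q.1ₚ

  ifb : Bool → Carrier
  ifb t = if t then 1# else 0#

  ∣?-∸ : ∀ K b → K ≤ b → does (K ∣? b) ≡ does (K ∣? (b ∸ K))
  ∣?-∸ K b p with K ∣? b | K ∣? (b ∸ K)
  ... | yes _ | yes _ = P.refl
  ... | no _ | no _ = P.refl
  ... | yes d | no nd = ⊥-elim (nd (∣m+n∣m⇒∣n (P.subst (K ∣_) (P.sym (NP.m+[n∸m]≡n p)) d) n∣n))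
  ... | no nd | yes d = ⊥-elim (nd (∣m∸n∣n⇒∣m K p d n∣n))

  geometric-inverse : ∀ k → geometric (suc k) Q.*ₚ (Q.1ₚ Q.+ₚ Q.-ₚ Q.monomial (suc k)) ≈Q Q.1ₚ
  geometric-inverse k = QC.trans step pt
    where
    K : ℕ
    K = suc k
    g : Q.PS
    g = geometric K
    step : g Q.*ₚ (Q.1ₚ Q.+ₚ Q.-ₚ Q.monomial K) ≈Q g Q.+ₚ Q.-ₚ Q.shift K g
    step = QC.trans (QC.distribˡ g Q.1ₚ (Q.-ₚ Q.monomial K))
           (QC.+-cong {g Q.*ₚ Q.1ₚ} {g} {g Q.*ₚ (Q.-ₚ Q.monomial K)} (QC.*-identityʳ g)
             (QC.trans (QC.sym (-‿distribʳ-* g (Q.monomial K)))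
               (QC.-‿cong {g Q.*ₚ Q.monomial K} {Q.shift K g}
                 (QC.trans (QC.*-comm g (Q.monomial K)) (Q.monomial-* K g)))))
    pt : g Q.+ₚ Q.-ₚ Q.shift K g ≈Q Q.1ₚ
    pt b with K ℕ.≤? b
    ... | yes p = trans (+-congˡ (-‿cong (trans (reflexive (shift-if K g b))
      (reflexive (P.trans (P.cong (λ t → if t then g (b ∸ K) else 0#) (≤ᵇ-true p))
        (P.cong ifb (P.sym (∣?-∸ K b p))))))))
                 (trans (-‿inverseʳ _) (z b p))
      where
      z : ∀ b → K ≤ b → 0# ≈ Q.1ₚ b
      z (suc b) _ = refl
    ... | no np = trans (+-congˡ (trans (-‿cong
      (trans (reflexive (shift-if K g b)) (reflexive
        (P.cong (λ t → if t then g (b ∸ K) else 0#) (≤ᵇ-false np))))) (ε⁻¹≈ε 0)))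
                 (trans (+-identityʳ _) (w b np))
      where
      w : ∀ b → ¬ (K ≤ b) → g b ≈ Q.1ₚ b
      w zero _ = reflexive (P.cong ifb (dec-true (K ∣? 0) (K ∣0)))
      w (suc b) nk = reflexive (P.cong ifb (dec-false (K ∣? suc b) (λ d → nk (∣⇒≤ d))))

  gaussDenominator⁻¹-step : ∀ s → gaussDenominator⁻¹ s ≈Q gaussDenominator⁻¹ (suc s) Q.*ₚ
    (Q.1ₚ Q.+ₚ Q.-ₚ Q.monomial (suc s))
  gaussDenominator⁻¹-step s = QC.trans (QC.sym (QC.*-identityʳ (gaussDenominator⁻¹ s)))
     (QC.trans (QC.*-congˡ {gaussDenominator⁻¹ s} (QC.sym (geometric-inverse s)))
       (QC.sym (QC.*-assoc (gaussDenominator⁻¹ s) (geometric (suc s)) (Q.1ₚ Q.+ₚ Q.-ₚ Q.monomial (suc s)))))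

  gaussNumerator-zero : ∀ m s → m < s → gaussNumerator m s ≈Q Q.0ₚ
  gaussNumerator-zero m s p = SQ.Π-zero s m _ p z
    where
    z : (Q.1ₚ Q.+ₚ Q.-ₚ Q.monomial (m ∸ m)) QC.≈ Q.0ₚ
    z rewrite NP.n∸n≡0 m = QC.-‿inverseʳ Q.1ₚ

  gauss-pascal : ∀ m s → gauss (suc m) (suc s) ≈Q gauss m (suc s) Q.+ₚ Q.monomial (m ∸ s) Q.*ₚ gauss m s
  gauss-pascal m s = QC.trans (QC.trans (gauss≈numerator*denominator⁻¹ (suc m) (suc s))
    (QC.*-congʳ {G'} (SQ.Π-head s _)))
    (QC.sym (QC.trans (QC.+-cong {gauss m (suc s)} {(N Q.*ₚ (Q.1ₚ Q.+ₚ Q.-ₚ Cc)) Q.*ₚ G'} {Cc Q.*ₚ gauss m s}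
      (gauss≈numerator*denominator⁻¹ m (suc s))
                                (QC.*-congˡ {Cc} (QC.trans (gauss≈numerator*denominator⁻¹ m s)
                                  (QC.*-congˡ {N} (gaussDenominator⁻¹-step s)))))
      alg))
    where
    N G' Cc Dd A : Q.PS
    N = gaussNumerator m s
    G' = gaussDenominator⁻¹ (suc s)
    Cc = Q.monomial (m ∸ s)
    Dd = Q.monomial (suc s)
    A = Q.monomial (suc m)
    alg : ((N Q.*ₚ (Q.1ₚ Q.+ₚ Q.-ₚ Cc)) Q.*ₚ G') Q.+ₚ (Cc Q.*ₚ (N Q.*ₚ (G' Q.*ₚ (Q.1ₚ Q.+ₚ Q.-ₚ Dd)))) ≈Q
      ((Q.1ₚ Q.+ₚ Q.-ₚ A) Q.*ₚ N) Q.*ₚ G'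
    alg with s ℕ.≤? m
    ... | yes p = RingIdentities.pascal-numerators QR N G' Cc Dd A
      (QC.trans (Q.monomial-+ (m ∸ s) (suc s)) (QC.reflexive (P.cong Q.monomial e)))
      where
      e : m ∸ s ℕ.+ suc s ≡ suc m
      e = P.trans (NP.+-suc (m ∸ s) s) (P.cong suc (NP.m∸n+n≡m p))
    ... | no np = RingIdentities.pascal-numerators-zero QR N G' Cc Dd A (gaussNumerator-zero m s (NP.≰⇒> np))

  open import Algebra.Properties.CommutativeSemigroup QC.*-commutativeSemigroup using (x∙yz≈y∙xz)

  triangle : ℕ → ℕ
  triangle k = (k ℕ.* suc k) / 2

  triangle-suc : ∀ k → triangle (suc k) ≡ triangle k ℕ.+ suc k
  triangle-suc k = P.trans (P.cong (_/ 2) e)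
    (P.trans (+-distrib-/-∣ʳ (k ℕ.* suc k) (divides-refl (suc k)))
      (P.cong (triangle k ℕ.+_) (m*n/n≡m (suc k) 2)))
    where
    e : suc k ℕ.* suc (suc k) ≡ k ℕ.* suc k ℕ.+ suc k ℕ.* 2
    e = solve 1 (λ k → (con 1 :+ k) :* (con 2 :+ k) := k :* (con 1 :+ k) :+ (con 1 :+ k) :* con 2) P.refl k

  gauss-0 : ∀ n → gauss n 0 ≈Q Q.1ₚ
  gauss-0 n = oneι 0

  gauss-zero : ∀ n s → n < s → gauss n s ≈Q Q.0ₚ
  gauss-zero n s p b rewrite ≤ᵇ-false {s} {n} (NP.<⇒≱ p) = refl

  qPochhammer : Carrier → ℕ → Ser
  qPochhammer t n = prodS n (λ j → Lin t (suc j))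

  qBinomialCoeff : Carrier → ℕ → ℕ → Q.PS
  qBinomialCoeff t n a = Q.const (powR (- t) a) Q.*ₚ (Q.monomial (triangle a) Q.*ₚ gauss n a)

  qBinomialCoeff-0 : ∀ t n → qBinomialCoeff t n 0 ≈Q Q.1ₚ
  qBinomialCoeff-0 t n = QC.trans (QC.*-cong {Q.const 1#} {Q.1ₚ} {Q.monomial 0 Q.*ₚ gauss n 0} {Q.1ₚ} Q.const-1
    (QC.trans (QC.*-identityˡ (gauss n 0)) (gauss-0 n))) (QC.*-identityˡ Q.1ₚ)

  qBinomialCoeff-zero : ∀ t n s → n < s → qBinomialCoeff t n s ≈Q Q.0ₚ
  qBinomialCoeff-zero t n s p = QC.trans (QC.*-congˡ {Q.const (powR (- t) s)}
    (QC.trans (QC.*-congˡ {Q.monomial (triangle s)} (gauss-zero n s p)) (QC.zeroʳ (Q.monomial (triangle s)))))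
      (QC.zeroʳ _)

  qBinomialCoeff-pascal-term : ∀ t n s →
    Q.const (powR (- t) (suc s)) Q.*ₚ (Q.monomial (triangle (suc s)) Q.*ₚ (Q.monomial (n ∸ s) Q.*ₚ gauss n s))
    ≈Q Q.-ₚ (Q.const t Q.*ₚ (Q.monomial (suc n) Q.*ₚ qBinomialCoeff t n s))
  qBinomialCoeff-pascal-term t n s with s ℕ.≤? n
  ... | yes p = begin
    cp' Q.*ₚ (qT' Q.*ₚ (Q.monomial (n ∸ s) Q.*ₚ B)) ≈⟨ QC.*-cong {cp'} {Q.-ₚ (ct Q.*ₚ cp)}
      (QC.trans (Q.const-*-const (- t) (powR (- t) s))
        (QC.trans (QC.*-congʳ {cp} (Q.const-neg t)) (QC.sym (-‿distribˡ-* ct cp))))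
          (QC.sym (QC.*-assoc qT' (Q.monomial (n ∸ s)) B)) ⟩
    Q.-ₚ (ct Q.*ₚ cp) Q.*ₚ ((qT' Q.*ₚ Q.monomial (n ∸ s)) Q.*ₚ B) ≈⟨ QC.*-congˡ {Q.-ₚ (ct Q.*ₚ cp)}
      (QC.*-congʳ {B} (QC.trans (Q.monomial-+ (triangle (suc s)) (n ∸ s))
        (QC.trans (QC.reflexive (P.cong Q.monomial e)) (QC.sym (Q.monomial-+ (suc n) (triangle s)))))) ⟩
    Q.-ₚ (ct Q.*ₚ cp) Q.*ₚ ((qn Q.*ₚ qT) Q.*ₚ B) ≈⟨ QC.sym (-‿distribˡ-* (ct Q.*ₚ cp) ((qn Q.*ₚ qT) Q.*ₚ B)) ⟩
    Q.-ₚ ((ct Q.*ₚ cp) Q.*ₚ ((qn Q.*ₚ qT) Q.*ₚ B)) ≈⟨ QC.-‿cong reassociate ⟩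
    Q.-ₚ (ct Q.*ₚ (qn Q.*ₚ (cp Q.*ₚ (qT Q.*ₚ B)))) ∎
    where
    open QS
    cp' cp ct qT' qT qn B : Q.PS
    cp' = Q.const (powR (- t) (suc s))
    cp = Q.const (powR (- t) s)
    ct = Q.const t
    qT' = Q.monomial (triangle (suc s))
    qT = Q.monomial (triangle s)
    qn = Q.monomial (suc n)
    B = gauss n s
    reassociate : (ct Q.*ₚ cp) Q.*ₚ ((qn Q.*ₚ qT) Q.*ₚ B) ≈Q ct Q.*ₚ (qn Q.*ₚ (cp Q.*ₚ (qT Q.*ₚ B)))
    reassociate = QC.trans (QC.*-assoc ct cp ((qn Q.*ₚ qT) Q.*ₚ B))
      (QC.*-congˡ {ct} (QC.trans (QC.*-congˡ {cp} (QC.*-assoc qn qT B)) (x∙yz≈y∙xz cp qn (qT Q.*ₚ B))))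
    e : triangle (suc s) ℕ.+ (n ∸ s) ≡ suc n ℕ.+ triangle s
    e = P.trans (P.cong (ℕ._+ (n ∸ s)) (triangle-suc s)) (P.trans (NP.+-assoc (triangle s) (suc s) (n ∸ s))
          (P.trans (P.cong (triangle s ℕ.+_) (P.cong suc (NP.m+[n∸m]≡n p))) (NP.+-comm (triangle s) (suc n))))
  ... | no np = QC.trans (QC.*-congˡ {cp'}
    (QC.trans (QC.*-congˡ {qT'} (QC.trans (QC.*-congˡ {Q.monomial (n ∸ s)} B≈0) (QC.zeroʳ _))) (QC.zeroʳ _)))
               (QC.trans (QC.zeroʳ cp') (QC.sym (QC.trans
                 (QC.-‿cong (QC.trans (QC.*-congˡ {ct} (QC.trans
                   (QC.*-congˡ {qn} (qBinomialCoeff-zero t n s (NP.≰⇒> np))) (QC.zeroʳ qn))) (QC.zeroʳ ct)))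
                     (λ b → ε⁻¹≈ε b))))
    where
    cp' ct qT' qn B : Q.PS
    cp' = Q.const (powR (- t) (suc s))
    ct = Q.const t
    qT' = Q.monomial (triangle (suc s))
    qn = Q.monomial (suc n)
    B = gauss n s
    B≈0 : B ≈Q Q.0ₚ
    B≈0 = gauss-zero n s (NP.≰⇒> np)

  qBinomialCoeff-step : ∀ t n s → qBinomialCoeff t (suc n) (suc s) ≈Q qBinomialCoeff t n (suc s) Q.+ₚ Q.-ₚ
    (Q.const t Q.*ₚ (Q.monomial (suc n) Q.*ₚ qBinomialCoeff t n s))
  qBinomialCoeff-step t n s = begin
    cp' Q.*ₚ (qT' Q.*ₚ gauss (suc n) (suc s)) ≈⟨ QC.*-congˡ {cp'} (QC.*-congˡ {qT'} (gauss-pascal n s)) ⟩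
    cp' Q.*ₚ (qT' Q.*ₚ (gauss n (suc s) Q.+ₚ Q.monomial (n ∸ s) Q.*ₚ B)) ≈⟨ QC.*-congˡ {cp'}
      (QC.distribˡ qT' (gauss n (suc s)) (Q.monomial (n ∸ s) Q.*ₚ B)) ⟩
    cp' Q.*ₚ (qT' Q.*ₚ gauss n (suc s) Q.+ₚ qT' Q.*ₚ (Q.monomial (n ∸ s) Q.*ₚ B)) ≈⟨ QC.distribˡ cp'
      (qT' Q.*ₚ gauss n (suc s)) (qT' Q.*ₚ (Q.monomial (n ∸ s) Q.*ₚ B)) ⟩
    qBinomialCoeff t n (suc s) Q.+ₚ cp' Q.*ₚ (qT' Q.*ₚ (Q.monomial (n ∸ s) Q.*ₚ B)) ≈⟨ QC.+-congˡ
      {qBinomialCoeff t n (suc s)} (qBinomialCoeff-pascal-term t n s) ⟩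
    qBinomialCoeff t n (suc s) Q.+ₚ Q.-ₚ (ct Q.*ₚ (qn Q.*ₚ qBinomialCoeff t n s)) ∎
    where
    open QS
    cp' ct qT' qn B : Q.PS
    cp' = Q.const (powR (- t) (suc s))
    ct = Q.const t
    qT' = Q.monomial (triangle (suc s))
    qn = Q.monomial (suc n)
    B = gauss n s

  q-binomial-theorem : ∀ t n a → qPochhammer t n a ≈Q qBinomialCoeff t n a
  q-binomial-theorem t zero zero = QC.trans (oneι 0) (QC.sym (qBinomialCoeff-0 t 0))
  q-binomial-theorem t zero (suc a) = QC.trans (oneι (suc a))
    (QC.sym (qBinomialCoeff-zero t 0 (suc a) (s≤s z≤n)))
  q-binomial-theorem t (suc n) zero = QC.trans (⊗-Lin-x⁰ (qPochhammer t n) t (suc n))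
    (QC.trans (q-binomial-theorem t n 0) (QC.trans (qBinomialCoeff-0 t n)
      (QC.sym (qBinomialCoeff-0 t (suc n)))))
  q-binomial-theorem t (suc n) (suc s) = QC.trans (⊗-Lin-x^suc (qPochhammer t n) t (suc n) s)
    (QC.trans (QC.+-cong {qPochhammer t n (suc s)} {qBinomialCoeff t n (suc s)} (q-binomial-theorem t n (suc s))
        (QC.-‿cong (QC.*-congˡ {Q.const t} (QC.*-congˡ {Q.monomial (suc n)} (q-binomial-theorem t n s)))))
      (QC.sym (qBinomialCoeff-step t n s)))

module ElementarySymmetric {c ℓ} (R : CommutativeRing c ℓ) where

  open import Data.Nat as ℕ using (ℕ; suc; _<_; s≤s)
  import Data.Nat.Properties as NP
  open import Data.Bool using (Bool; true; false; if_then_else_)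
  open import Data.List using (List; []; _∷_; map; _++_)
  open import Data.Vec using (Vec; []; _∷_)
  open import Relation.Nullary using (does)
  import Relation.Binary.PropositionalEquality as P
  import Relation.Binary.Reasoning.Setoid as SetR
  import Data.List.Properties as LP
  open import Defs

  open CommutativeRing R
  open Def R
  open SetR setoid

  sumList-++ : ∀ xs ys → sumList (xs ++ ys) ≈ sumList xs + sumList ys
  sumList-++ [] ys = sym (+-identityˡ _)
  sumList-++ (x ∷ xs) ys = trans (+-congˡ (sumList-++ xs ys)) (sym (+-assoc _ _ _))

  sumList-allBools-suc : ∀ {s} (H : Vec Bool (suc s) → Carrier) →
    sumList (map H (allBools (suc s))) ≈
    sumList (map (λ b → H (false ∷ b)) (allBools s)) + sumList (map (λ b → H (true ∷ b)) (allBools s))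
  sumList-allBools-suc {s} H = begin
    sumList (map H (map (false ∷_) B ++ map (true ∷_) B))
      ≡⟨ P.cong sumList (LP.map-++ H (map (false ∷_) B) (map (true ∷_) B)) ⟩
    sumList (map H (map (false ∷_) B) ++ map H (map (true ∷_) B))
      ≈⟨ sumList-++ (map H (map (false ∷_) B)) (map H (map (true ∷_) B)) ⟩
    sumList (map H (map (false ∷_) B)) + sumList (map H (map (true ∷_) B))
      ≡⟨ P.sym (P.cong₂ (λ xs ys → sumList xs + sumList ys) (LP.map-∘ B) (LP.map-∘ B)) ⟩
    sumList (map (λ b → H (false ∷ b)) B) + sumList (map (λ b → H (true ∷ b)) B) ∎
    where B = allBools s

  sumList-if-*ˡ : ∀ {A : Set} x (t : A → Bool) (p : A → Carrier) (L : List A) →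
    x * sumList (map (λ b → if t b then p b else 0#) L) ≈ sumList (map (λ b → if t b then x * p b else 0#) L)
  sumList-if-*ˡ x t p [] = zeroʳ x
  sumList-if-*ˡ x t p (b ∷ L) = trans (distribˡ x _ _) (+-cong (if-*ˡ (t b)) (sumList-if-*ˡ x t p L))
    where
    if-*ˡ : ∀ tb → x * (if tb then p b else 0#) ≈ (if tb then x * p b else 0#)
    if-*ˡ true = refl
    if-*ˡ false = zeroʳ x

  sumList-zero : ∀ {A : Set} (L : List A) → sumList (map (λ _ → 0#) L) ≈ 0#
  sumList-zero [] = refl
  sumList-zero (x ∷ L) = trans (+-congˡ (sumList-zero L)) (+-identityʳ 0#)

  esym-[]-0 : esym 0 [] ≈ 1#
  esym-[]-0 = +-identityʳ 1#

  esym-[]-suc : ∀ n → esym (suc n) [] ≈ 0#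
  esym-[]-suc n = +-identityʳ 0#

  esym-∷-0 : ∀ {s} x (v : Vec Carrier s) → esym 0 (x ∷ v) ≈ esym 0 v
  esym-∷-0 {s} x v =
    trans (sumList-allBools-suc (λ b → if does (countTrue b ℕ.≟ 0) then prodSel b (x ∷ v) else 0#))
      (trans (+-congˡ (sumList-zero (allBools s))) (+-identityʳ _))

  esym-∷ : ∀ {s} n x (v : Vec Carrier s) → esym (suc n) (x ∷ v) ≈ esym (suc n) v + x * esym n v
  esym-∷ {s} n x v =
    trans (sumList-allBools-suc (λ b → if does (countTrue b ℕ.≟ suc n) then prodSel b (x ∷ v) else 0#))
    (+-congˡ (sym (sumList-if-*ˡ x (λ b → does (countTrue b ℕ.≟ n)) (λ b → prodSel b v) (allBools s))))

  esym-0 : ∀ {s} (v : Vec Carrier s) → esym 0 v ≈ 1#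
  esym-0 [] = esym-[]-0
  esym-0 (x ∷ v) = trans (esym-∷-0 x v) (esym-0 v)

  esym-> : ∀ {s} (v : Vec Carrier s) n → s < n → esym n v ≈ 0#
  esym-> [] (suc n) _ = esym-[]-suc n
  esym-> (x ∷ v) (suc n) (s≤s p) = trans (esym-∷ n x v)
     (trans (+-cong (esym-> v (suc n) (NP.m<n⇒m<1+n p)) (trans (*-congˡ (esym-> v n p)) (zeroʳ x)))
       (+-identityʳ 0#))

module LeftHandSide {c ℓ} (R : CommutativeRing c ℓ) (r' : ℕ)
  (u : Vec (CommutativeRing.Carrier R) (suc r')) (d : CommutativeRing.Carrier R) where

  open import Data.Nat as ℕ using (zero; _∸_; _≤_)
  import Data.Nat.Properties as NP
  open import Data.Vec using ([]; _∷_; init; last)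
  import Relation.Binary.PropositionalEquality as P
  open import Defs

  open CommutativeRing R
  open Def R
  open Params r' u d
  open SeriesRing R
  open SeriesOperations R
  open ElementarySymmetric R
  open RingIdentities R
  open import Algebra.Properties.Group +-group using (ε⁻¹≈ε)

  oneMinusDX : Carrier → Ser
  oneMinusDX w = oneS ⊖ scal (d * w) ⊗ X

  prodVec-coeff : ∀ {s} (v : Vec Carrier s) a → prodVec v oneMinusDX a ≈Q Q.const (powR (- d) a * esym a v)
  prodVec-coeff [] zero = QC.trans (oneι 0)
    (QC.sym (QC.trans (Q.const-cong (trans (*-identityˡ _) esym-[]-0)) Q.const-1))
  prodVec-coeff [] (suc a) = QC.sym (QC.trans (Q.const-cong (trans (*-congˡ (esym-[]-suc a)) (zeroʳ _)))
    Q.const-0)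
  prodVec-coeff (w ∷ v) zero = QC.trans (⊗-comm (oneMinusDX w) (prodVec v oneMinusDX) 0)
    (QC.trans (⊗-Lin-x⁰ (prodVec v oneMinusDX) (d * w) 0)
      (QC.trans (prodVec-coeff v 0) (Q.const-cong (*-congˡ (sym (esym-∷-0 w v))))))
  prodVec-coeff (w ∷ v) (suc s) = QC.trans (⊗-comm (oneMinusDX w) (prodVec v oneMinusDX) (suc s))
    (QC.trans (⊗-Lin-x^suc (prodVec v oneMinusDX) (d * w) 0 s)
    (QC.trans (QC.+-cong {G (suc s)} {Q.const (p' * e'')} (prodVec-coeff v (suc s))
                 (QC.-‿cong (QC.trans (QC.*-congˡ {Q.const (d * w)}
                   (QC.trans (Q.*ₚ-identityˡ (G s)) (prodVec-coeff v s)))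
                     (QC.sym (Q.const-*-const (d * w) (p * e))))))
    (QC.trans (QC.sym (QC.trans (Q.const-+ (p' * e'') (- ((d * w) * (p * e))))
      (QC.+-congˡ {Q.const (p' * e'')} (Q.const-neg ((d * w) * (p * e))))))
       (Q.const-cong (trans (sym (esym-coefficient-step d p w e e'')) (*-congˡ (sym (esym-∷ s w v))))))))
    where
    G : Ser
    G = prodVec v oneMinusDX
    p p' e'' e : Carrier
    p = powR (- d) s
    p' = - d * p
    e'' = esym (suc s) v
    e = esym s v

  prodVec-init-last : ∀ n (v : Vec Carrier (suc n)) (g : Carrier → Ser) → prodVec v g ≋ prodVec (init v) g ⊗
    g (last v)
  prodVec-init-last zero (x ∷ []) g = S.*-comm (g x) oneS
  prodVec-init-last (suc n) (x ∷ v) g = S.trans (⊗-congˡ (g x) (prodVec-init-last n v g))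
    (S.sym (S.*-assoc (g x) (prodVec (init v) g) (g (last v))))

  lhsCoeff : ℕ → Carrier
  lhsCoeff i = powR d (i ∸ 1) * esym (i ∸ 1) u⁻ + powR d i * esym i u⁻

  lhsTerm : ℕ → Ser
  lhsTerm i = powS negX i ⊗ scal (lhsCoeff i)

  signedCoeff : ℕ → Ser
  signedCoeff i = scal (powR (- 1#) i) ⊗ scal (lhsCoeff i)

  signedCoeff-x⁰ : ∀ i → signedCoeff i 0 ≈Q Q.const (powR (- 1#) i * lhsCoeff i)
  signedCoeff-x⁰ i = QC.trans (scal-⊗ (powR (- 1#) i) (scal (lhsCoeff i)) 0)
    (QC.trans (QC.*-congˡ {Q.const (powR (- 1#) i)} (scal≋ (lhsCoeff i) 0)) (QC.sym (Q.const-*-const _ _)))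

  Π⁻ : Ser
  Π⁻ = prodVec u⁻ oneMinusDX

  lhs′ : Ser
  lhs′ = oneS ⊕ sumS 1 r lhsTerm

  -- Π⁻ has coefficients (-d)^a e_a(u⁻) (prodVec-coeff), and multiplying by 1 - x
  -- combines consecutive ones into ± lhsCoeff.
  lhs′-factor : lhs′ ≋ Π⁻ ⊗ (oneS ⊖ X)
  lhs′-factor a = QC.trans (QC.+-congˡ {oneS a}
    (QC.trans (sumS≈ 1 r lhsTerm a) (SQ.Σ-cong r (λ j → powS-negX-⊗ (suc j) (scal (lhsCoeff (suc j))) a))))
            (QC.trans (coefficientwise a) (QC.sym (⊗-1-X Π⁻ a)))
    where
    coefficientwise : ∀ a → (oneS a Q.+ₚ SQ.Σ r (λ j → XQ.shift (suc j) (signedCoeff (suc j)) a)) ≈Q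
      (Π⁻ ⊖ XQ.shift 1 Π⁻) a
    coefficientwise zero = QC.trans (QC.+-cong {oneS 0} {Q.1ₚ} (oneι 0) (SQ.Σ-zero r (λ j _ → QC.refl)))
               (QC.trans (QC.+-identityʳ Q.1ₚ) (QC.sym (QC.trans (QC.+-congˡ {Π⁻ 0} (λ b → ε⁻¹≈ε))
                 (QC.trans (QC.+-identityʳ (Π⁻ 0)) (QC.trans (prodVec-coeff u⁻ 0)
                   (QC.trans (Q.const-cong (trans (*-identityˡ _) (esym-0 u⁻))) Q.const-1))))))
    coefficientwise (suc s) = QC.trans (QC.+-identityˡ _)
      (QC.trans (SQ.Σ-single r s {λ j → XQ.shift j (signedCoeff (suc j)) s}
        (λ m ne → shift-XFree-off m (signedCoeff (suc m))
          (XFree-scal-⊗ (powR (- 1#) (suc m)) (scal (lhsCoeff (suc m))) (XFree-scal (lhsCoeff (suc m)))) s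
            (λ e → ne (P.sym e)))
                   (λ p → QC.trans (QC.reflexive (shift-XFree-at s (signedCoeff (suc s))))
                     (QC.trans (signedCoeff-x⁰ (suc s)) (QC.trans
                       (Q.const-cong (trans (*-congˡ (vanish p)) (zeroʳ _))) Q.const-0))))
      (QC.trans (QC.reflexive (shift-XFree-at s (signedCoeff (suc s))))
      (QC.trans (signedCoeff-x⁰ (suc s))
      (QC.trans (Q.const-cong (signed-power-split d s (esym s u⁻) (esym (suc s) u⁻)))
      (QC.trans (Q.const-+ _ _)
      (QC.trans (QC.+-congˡ {Q.const (powR (- d) (suc s) * esym (suc s) u⁻)} (Q.const-neg _))
      (QC.sym (QC.+-cong {Π⁻ (suc s)} {Q.const (powR (- d) (suc s) * esym (suc s) u⁻)}
        (prodVec-coeff u⁻ (suc s)) (QC.-‿cong (prodVec-coeff u⁻ s))))))))))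
      where
      vanish : r ≤ s → lhsCoeff (suc s) ≈ 0#
      vanish p = trans (+-cong (trans (*-congˡ (esym-> u⁻ s (NP.<-≤-trans (NP.n<1+n r') p))) (zeroʳ _))
                               (trans (*-congˡ (esym-> u⁻ (suc s) (NP.<-≤-trans (NP.n<1+n r')
                                 (NP.m≤n⇒m≤1+n p)))) (zeroʳ _))) (+-identityʳ 0#)

  prodVec-split-last : prodVec u oneMinusDX ≋ Π⁻ ⊗ oneMinusDX ur
  prodVec-split-last = prodVec-init-last r' u oneMinusDX

module RightHandSide {c ℓ} (R : CommutativeRing c ℓ) (r' : ℕ)
  (u : Vec (CommutativeRing.Carrier R) (suc r')) (d : CommutativeRing.Carrier R) where

  open import Data.Nat as ℕ using (zero; _∸_; _<_; _≤_; s≤s; _⊓_)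
  import Data.Nat.Properties as NP
  open import Data.Empty using (⊥-elim)
  open import Relation.Nullary using (yes; no)
  open import Relation.Binary.PropositionalEquality as P using (_≡_)
  open import Defs

  open CommutativeRing R
  open Def R
  open Params r' u d
  open SeriesRing R
  open SeriesOperations R
  open QBinomial R
  open ElementarySymmetric R
  open RingIdentities R using (powR-neg-*)

  z : Carrier
  z = d * ur

  -- T i and T′ i are the coefficients of f(xq^i) in (eq_r) (without the product
  -- ∏_{h=1}^{i-1} (1 - x q^h)) and of F(xq^i) in the transformed equation.
  T : ℕ → Ser
  T i = sumS 0 (r ∸ i) (λ m → scal (powR d m * esym (i ℕ.+ m) u) ⊗ X ⊗ innerr i m)

  T′ : ℕ → Ser
  T′ i = sumS 1 r (λ l → sumS 0 ((i ∸ 1) ⊓ (l ∸ 1))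
    (λ k → cc k i ⊗ bb (l ∸ k) i ⊗ scal (powR (- 1#) (l ∸ 1)) ⊗ powS X l))

  ΠLin : ℕ → Ser
  ΠLin i = prodFT 1 (i ∸ 1) (Lin z)

  module AtIndex (i' : ℕ) (ir : suc i' ≤ r) where

    dE : ℕ → Carrier
    dE m = powR d m * esym (suc i' ℕ.+ m) u

    dE-vanish : ∀ m → r < suc i' ℕ.+ m → dE m ≈ 0#
    dE-vanish m p = trans (*-congˡ (esym-> u (suc i' ℕ.+ m) p)) (zeroʳ _)

    Zβ : ℕ → Ser
    Zβ m = scal (powR (- 1#) m) ⊗ qbin (suc i' ℕ.+ m) m

    XFree-Zβ : ∀ m → XFree (Zβ m)
    XFree-Zβ m = XFree-scal-⊗ (powR (- 1#) m) (qbin (suc i' ℕ.+ m) m) (XFree-qbin (suc i' ℕ.+ m) m)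

    -- β m = (-x)^m [i+m m]_q, so that innerr (suc i') (suc m) = β m + β (suc m)
    β : ℕ → Ser
    β m = powS negX m ⊗ qbin (suc i' ℕ.+ m) m

    β≋ : ∀ m → β m ≋ XQ.shift m (Zβ m)
    β≋ m = powS-negX-⊗ m (qbin (suc i' ℕ.+ m) m)

    innerr-0 : innerr (suc i') 0 ≋ β 0
    innerr-0 a b = reflexive (P.cong (λ t → (powS negX 0 ⊗ qbin t 0) a b) (P.sym (NP.+-identityʳ (suc i'))))

    T-term : ∀ m → scal (dE m) ⊗ X ⊗ innerr (suc i') m ≋ XQ.shift 1 (scal (dE m) ⊗ innerr (suc i') m)
    T-term m = S.trans (⊗-congʳ (innerr (suc i') m) (S.*-comm (scal (dE m)) X))
      (S.trans (S.*-assoc X (scal (dE m)) (innerr (suc i') m)) (X-⊗ (scal (dE m) ⊗ innerr (suc i') m)))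

    N : ℕ
    N = r ∸ suc i'

    T-as-Σ : ∀ a → T (suc i') a ≈Q SQ.Σ (suc N) (λ m → XQ.shift 1 (scal (dE m) ⊗ innerr (suc i') m) a)
    T-as-Σ a = QC.trans (sumS≈ 0 N (λ m → scal (dE m) ⊗ X ⊗ innerr (suc i') m) a)
      (SQ.Σ-cong (suc N) (λ m → T-term m a))

    T-x⁰ : T (suc i') 0 ≈Q Q.0ₚ
    T-x⁰ = QC.trans (T-as-Σ 0) (SQ.Σ-zero (suc N) (λ _ _ → QC.refl))

    gaussᵢ : ℕ → Q.PS
    gaussᵢ s = gauss (suc i' ℕ.+ s) s

    Zβ-x⁰ : ∀ s → Zβ s 0 ≈Q Q.const (powR (- 1#) s) Q.*ₚ gaussᵢ s
    Zβ-x⁰ s = scal-⊗ (powR (- 1#) s) (qbin (suc i' ℕ.+ s) s) 0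

    Tcoeff : ℕ → Q.PS
    Tcoeff s = Q.const (dE s) Q.*ₚ (Q.const (powR (- 1#) s) Q.*ₚ gaussᵢ s) Q.+ₚ Q.const (dE (suc s)) Q.*ₚ
      (Q.const (powR (- 1#) s) Q.*ₚ gaussᵢ s)

    dEβ : ∀ m s → Q.PS
    dEβ m s = Q.const (dE m) Q.*ₚ β m s

    beyond-r : ∀ s → suc N ≤ s → r < suc i' ℕ.+ s
    beyond-r s p = P.subst (_< suc i' ℕ.+ s) (NP.m+[n∸m]≡n ir) (NP.+-monoʳ-< (suc i') p)

    beyond-r-suc : ∀ s → N ≤ s → r < suc i' ℕ.+ suc s
    beyond-r-suc s p = P.subst (_< suc i' ℕ.+ suc s) (NP.m+[n∸m]≡n ir) (NP.+-monoʳ-< (suc i') (s≤s p))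

    Σ-dEβ : ∀ s → SQ.Σ (suc N) (λ m → dEβ m s) ≈Q Q.const (dE s) Q.*ₚ (Q.const (powR (- 1#) s) Q.*ₚ gaussᵢ s)
    Σ-dEβ s = QC.trans (SQ.Σ-single (suc N) s {λ m → dEβ m s}
                (λ m ne → QC.trans (QC.*-congˡ {Q.const (dE m)}
                  (QC.trans (β≋ m s) (shift-XFree-off m (Zβ m) (XFree-Zβ m) s (λ e → ne (P.sym e)))))
                    (QC.zeroʳ (Q.const (dE m))))
                (λ p → QC.trans (QC.*-congʳ {β s s} (QC.trans (Q.const-cong (dE-vanish s (beyond-r s p)))
                  Q.const-0)) (QC.zeroˡ (β s s))))
              (QC.*-congˡ {Q.const (dE s)} (QC.trans (β≋ s s)
                (QC.trans (QC.reflexive (shift-XFree-at s (Zβ s))) (Zβ-x⁰ s))))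

    Σ-dEβ-suc : ∀ s → SQ.Σ N (λ m → Q.const (dE (suc m)) Q.*ₚ β m s) ≈Q Q.const (dE (suc s)) Q.*ₚ
      (Q.const (powR (- 1#) s) Q.*ₚ gaussᵢ s)
    Σ-dEβ-suc s = QC.trans (SQ.Σ-single N s {λ m → Q.const (dE (suc m)) Q.*ₚ β m s}
                (λ m ne → QC.trans (QC.*-congˡ {Q.const (dE (suc m))}
                  (QC.trans (β≋ m s) (shift-XFree-off m (Zβ m) (XFree-Zβ m) s (λ e → ne (P.sym e)))))
                    (QC.zeroʳ (Q.const (dE (suc m)))))
                (λ p → QC.trans (QC.*-congʳ {β s s} (QC.trans
                  (Q.const-cong (dE-vanish (suc s) (beyond-r-suc s p))) Q.const-0)) (QC.zeroˡ (β s s))))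
              (QC.*-congˡ {Q.const (dE (suc s))} (QC.trans (β≋ s s)
                (QC.trans (QC.reflexive (shift-XFree-at s (Zβ s))) (Zβ-x⁰ s))))

    Σ-innerr-split : ∀ s → SQ.Σ (suc N) (λ m → Q.const (dE m) Q.*ₚ innerr (suc i') m s) ≈Q SQ.Σ (suc N)
      (λ m → dEβ m s) Q.+ₚ SQ.Σ N (λ m → Q.const (dE (suc m)) Q.*ₚ β m s)
    Σ-innerr-split s = begin
      SQ.Σ (suc N) (λ m → Q.const (dE m) Q.*ₚ innerr (suc i') m s) ≈⟨ SQ.Σ-head N _ ⟩
      Q.const (dE 0) Q.*ₚ innerr (suc i') 0 s Q.+ₚ SQ.Σ N
        (λ m → Q.const (dE (suc m)) Q.*ₚ (β m s Q.+ₚ β (suc m) s))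
        ≈⟨ QC.+-cong {Q.const (dE 0) Q.*ₚ innerr (suc i') 0 s} {dEβ 0 s}
          (QC.*-congˡ {Q.const (dE 0)} (innerr-0 s))
             (SQ.Σ-cong N (λ m → QC.trans (QC.distribˡ (Q.const (dE (suc m))) (β m s) (β (suc m) s))
               (QC.+-comm _ _))) ⟩
      dEβ 0 s Q.+ₚ SQ.Σ N (λ m → dEβ (suc m) s Q.+ₚ Q.const (dE (suc m)) Q.*ₚ β m s)
        ≈⟨ QC.+-congˡ {dEβ 0 s} (SQ.Σ-+ N (λ m → dEβ (suc m) s) (λ m → Q.const (dE (suc m)) Q.*ₚ β m s)) ⟩
      dEβ 0 s Q.+ₚ (SQ.Σ N (λ m → dEβ (suc m) s) Q.+ₚ SQ.Σ N (λ m → Q.const (dE (suc m)) Q.*ₚ β m s))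
        ≈⟨ QC.sym (QC.+-assoc (dEβ 0 s) _ _) ⟩
      (dEβ 0 s Q.+ₚ SQ.Σ N (λ m → dEβ (suc m) s)) Q.+ₚ SQ.Σ N (λ m → Q.const (dE (suc m)) Q.*ₚ β m s)
        ≈⟨ QC.+-congʳ {SQ.Σ N (λ m → Q.const (dE (suc m)) Q.*ₚ β m s)} (QC.sym (SQ.Σ-head N (λ m → dEβ m s))) ⟩
      SQ.Σ (suc N) (λ m → dEβ m s) Q.+ₚ SQ.Σ N (λ m → Q.const (dE (suc m)) Q.*ₚ β m s) ∎
      where open QS

    T-x^suc : ∀ s → T (suc i') (suc s) ≈Q Tcoeff s
    T-x^suc s = QC.trans (T-as-Σ (suc s)) (QC.trans
      (SQ.Σ-cong (suc N) (λ m → scal-⊗ (dE m) (innerr (suc i') m) s))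
                (QC.trans (Σ-innerr-split s) (QC.+-cong {SQ.Σ (suc N) (λ m → dEβ m s)}
                  {Q.const (dE s) Q.*ₚ (Q.const (powR (- 1#) s) Q.*ₚ gaussᵢ s)} (Σ-dEβ s) (Σ-dEβ-suc s))))

    Y : ℕ → ℕ → Ser
    Y l k = cc k (suc i') ⊗ bb (l ∸ k) (suc i') ⊗ scal (powR (- 1#) (l ∸ 1))

    XFree-cc : ∀ k → XFree (cc k (suc i'))
    XFree-cc k = XFree-⊗ (scal (powR d k * powR ur k) ⊗ qmono (triangle k)) (qbin (suc i' ∸ 1) k)
      (XFree-⊗ (scal (powR d k * powR ur k)) (qmono (triangle k)) (XFree-scal (powR d k * powR ur k))
        (XFree-qmono (triangle k))) (XFree-qbin (suc i' ∸ 1) k)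

    XFree-bb : ∀ m → XFree (bb m (suc i'))
    XFree-bb m = XFree-scal-⊗ (powR d (m ∸ 1) * esym (suc i' ℕ.+ m ∸ 1) u + powR d m * esym (suc i' ℕ.+ m)
      u) (qbin (suc i' ℕ.+ m ∸ 1) (m ∸ 1)) (XFree-qbin (suc i' ℕ.+ m ∸ 1) (m ∸ 1))

    XFree-Y : ∀ l k → XFree (Y l k)
    XFree-Y l k = XFree-⊗ (cc k (suc i') ⊗ bb (l ∸ k) (suc i')) (scal (powR (- 1#) (l ∸ 1)))
      (XFree-⊗ (cc k (suc i')) (bb (l ∸ k) (suc i')) (XFree-cc k) (XFree-bb (l ∸ k)))
        (XFree-scal (powR (- 1#) (l ∸ 1)))

    Y⊗X^l : ∀ l k → Y l k ⊗ powS X l ≋ XQ.shift l (Y l k)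
    Y⊗X^l l k = S.trans (S.*-comm (Y l k) (powS X l)) (powX-⊗ l (Y l k))

    T′-as-Σ : ∀ a → T′ (suc i') a ≈Q SQ.Σ r (λ j → SQ.Σ (suc (i' ⊓ j)) (λ k → XQ.shift (suc j) (Y (suc j) k) a))
    T′-as-Σ a = QC.trans (sumS≈ 1 r (λ l → sumS 0 ((suc i' ∸ 1) ⊓ (l ∸ 1)) (λ k → Y l k ⊗ powS X l)) a)
      (SQ.Σ-cong r (λ j → QC.trans (sumS≈ 0 (i' ⊓ j) (λ k → Y (suc j) k ⊗ powS X (suc j)) a)
                            (SQ.Σ-cong (suc (i' ⊓ j)) (λ k → Y⊗X^l (suc j) k a))))

    T′-x⁰ : T′ (suc i') 0 ≈Q Q.0ₚ
    T′-x⁰ = QC.trans (T′-as-Σ 0) (SQ.Σ-zero r (λ j _ → SQ.Σ-zero (suc (i' ⊓ j)) (λ _ _ → QC.refl)))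

    cc-x⁰ : ∀ k → cc k (suc i') 0 ≈Q (Q.const (powR d k * powR ur k) Q.*ₚ Q.monomial (triangle k)) Q.*ₚ
      gauss i' k
    cc-x⁰ k = QC.trans (⊗-x⁰ (scal (powR d k * powR ur k) ⊗ qmono (triangle k)) (qbin (suc i' ∸ 1) k))
             (QC.*-congʳ {gauss i' k} (QC.trans (scal-⊗ (powR d k * powR ur k) (qmono (triangle k)) 0)
               (QC.*-congˡ {Q.const (powR d k * powR ur k)} (qmono≋ (triangle k) 0))))

    index-shift : ∀ m → suc i' ℕ.+ suc m ∸ 1 ≡ suc i' ℕ.+ m
    index-shift m = P.cong (_∸ 1) (NP.+-suc (suc i') m)

    bb-x⁰ : ∀ m → bb (suc m) (suc i') 0 ≈Q Q.const (dE m + dE (suc m)) Q.*ₚ gaussᵢ m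
    bb-x⁰ m = QC.trans (scal-⊗ _ (qbin (suc i' ℕ.+ suc m ∸ 1) m) 0)
      (QC.*-cong {Q.const (powR d m * esym (suc i' ℕ.+ suc m ∸ 1) u + powR d (suc m) * esym
        (suc i' ℕ.+ suc m) u)} {Q.const (dE m + dE (suc m))}
         (Q.const-cong (reflexive (P.cong (λ t → powR d m * esym t u + powR d (suc m) * esym
           (suc i' ℕ.+ suc m) u) (index-shift m))))
         (QC.reflexive (P.cong (λ t → gauss t m) (index-shift m))))

    Ycoeff : ℕ → ℕ → Q.PS
    Ycoeff s k = (cc k (suc i') 0 Q.*ₚ bb (suc s ∸ k) (suc i') 0) Q.*ₚ Q.const (powR (- 1#) s)

    Y-x⁰ : ∀ s k → Y (suc s) k 0 ≈Q Ycoeff s k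
    Y-x⁰ s k = QC.trans (⊗-x⁰ (cc k (suc i') ⊗ bb (suc s ∸ k) (suc i')) (scal (powR (- 1#) s)))
               (QC.*-cong {(cc k (suc i') ⊗ bb (suc s ∸ k) (suc i')) 0}
                 {cc k (suc i') 0 Q.*ₚ bb (suc s ∸ k) (suc i') 0}
                   (⊗-x⁰ (cc k (suc i')) (bb (suc s ∸ k) (suc i'))) (scal≋ (powR (- 1#) s) 0))

    bb-vanish : ∀ s k → k ≤ i' → k ≤ s → r ≤ s → bb (suc s ∸ k) (suc i') 0 ≈Q Q.0ₚ
    bb-vanish s k p q rs = QC.trans (QC.reflexive (P.cong (λ t → bb t (suc i') 0) (NP.+-∸-assoc 1 q)))
        (QC.trans (bb-x⁰ (s ∸ k)) (QC.trans (QC.*-congʳ {gaussᵢ (s ∸ k)}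
          (QC.trans (Q.const-cong (trans (+-cong (dE-vanish (s ∸ k) lt1) (dE-vanish (suc (s ∸ k)) lt2))
            (+-identityʳ 0#))) Q.const-0)) (QC.zeroˡ (gaussᵢ (s ∸ k)))))
      where
      le : s ≤ i' ℕ.+ (s ∸ k)
      le = P.subst (_≤ i' ℕ.+ (s ∸ k)) (NP.m+[n∸m]≡n q) (NP.+-monoˡ-≤ (s ∸ k) p)
      lt1 : r < suc i' ℕ.+ (s ∸ k)
      lt1 = s≤s (NP.≤-trans rs le)
      lt2 : r < suc i' ℕ.+ suc (s ∸ k)
      lt2 = NP.<-≤-trans lt1 (NP.+-monoʳ-≤ (suc i') (NP.n≤1+n (s ∸ k)))

    T′-x^suc : ∀ s → T′ (suc i') (suc s) ≈Q SQ.Σ (suc (i' ⊓ s)) (Ycoeff s)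
    T′-x^suc s = QC.trans (T′-as-Σ (suc s))
      (QC.trans (SQ.Σ-single r s {λ j → SQ.Σ (suc (i' ⊓ j)) (λ k → XQ.shift j (Y (suc j) k) s)}
                  (λ m ne → SQ.Σ-zero (suc (i' ⊓ m)) (λ k _ → shift-XFree-off m (Y (suc m) k)
                    (XFree-Y (suc m) k) s (λ e → ne (P.sym e))))
                  (λ rs → SQ.Σ-zero (suc (i' ⊓ s)) (λ k p → QC.trans
                    (QC.reflexive (shift-XFree-at s (Y (suc s) k)))
                      (QC.trans (Y-x⁰ s k) (QC.trans (QC.*-congʳ {Q.const (powR (- 1#) s)}
                        (QC.trans (QC.*-congˡ {cc k (suc i') 0} (bb-vanish s k
                          (NP.≤-trans (NP.≤-pred p) (NP.m⊓n≤m i' s)) (NP.≤-trans (NP.≤-pred p) (NP.m⊓n≤n i' s))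
                            rs)) (QC.zeroʳ (cc k (suc i') 0)))) (QC.zeroˡ (Q.const (powR (- 1#) s))))))))
      (SQ.Σ-cong (suc (i' ⊓ s)) (λ k → QC.trans (QC.reflexive (shift-XFree-at s (Y (suc s) k))) (Y-x⁰ s k))))

    open import Algebra.Properties.CommutativeSemigroup QC.*-commutativeSemigroup using () renaming
      (x∙yz≈y∙xz to x∙yz≈y∙xzQ)

    TSform : ∀ m → Tcoeff m ≈Q Q.const (powR (- 1#) m) Q.*ₚ (Q.const (dE m + dE (suc m)) Q.*ₚ gaussᵢ m)
    TSform m = QC.trans (QC.sym (QC.distribʳ (Q.const (powR (- 1#) m) Q.*ₚ gaussᵢ m) (Q.const (dE m))
      (Q.const (dE (suc m)))))
      (QC.trans (QC.*-congʳ {Q.const (powR (- 1#) m) Q.*ₚ gaussᵢ m} (QC.sym (Q.const-+ (dE m) (dE (suc m)))))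
        (x∙yz≈y∙xzQ (Q.const (dE m + dE (suc m))) (Q.const (powR (- 1#) m)) (gaussᵢ m)))

    coefficient-match : ∀ s k → k < suc s → qBinomialCoeff z i' k Q.*ₚ Tcoeff (s ∸ k) ≈Q Ycoeff s k
    coefficient-match s k p with i' ℕ.<? k
    ... | yes ik = QC.trans (QC.*-congʳ {Tcoeff (s ∸ k)} (qBinomialCoeff-zero z i' k ik))
      (QC.trans (QC.zeroˡ (Tcoeff (s ∸ k)))
         (QC.sym (QC.trans (QC.*-congʳ {Q.const (powR (- 1#) s)}
           (QC.trans (QC.*-congʳ {bb (suc s ∸ k) (suc i') 0}
             (QC.trans (cc-x⁰ k) (QC.trans (QC.*-congˡ
               {Q.const (powR d k * powR ur k) Q.*ₚ Q.monomial (triangle k)} (gauss-zero i' k ik))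
                 (QC.zeroʳ _)))) (QC.zeroˡ (bb (suc s ∸ k) (suc i') 0))))
                   (QC.zeroˡ (Q.const (powR (- 1#) s))))))
    ... | no nik = begin
      (A Q.*ₚ (qT Q.*ₚ q2)) Q.*ₚ Tcoeff m ≈⟨ QC.*-congˡ {A Q.*ₚ (qT Q.*ₚ q2)} (TSform m) ⟩
      (A Q.*ₚ (qT Q.*ₚ q2)) Q.*ₚ (σm Q.*ₚ (Ec Q.*ₚ gaussᵢ m)) ≈⟨ RingIdentities.*-exchange-scalar QR A qT q2 σm
        Ec (gaussᵢ m) Bc σs sc ⟩
      (((Bc Q.*ₚ qT) Q.*ₚ q2) Q.*ₚ (Ec Q.*ₚ gaussᵢ m)) Q.*ₚ σs ≈⟨ QC.*-congʳ {σs}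
        (QC.*-cong {(Bc Q.*ₚ qT) Q.*ₚ q2} {cc k (suc i') 0} {Ec Q.*ₚ gaussᵢ m} {bb (suc s ∸ k) (suc i') 0}
               (QC.sym (cc-x⁰ k)) (QC.sym (QC.trans (QC.reflexive
                 (P.cong (λ t → bb t (suc i') 0) (NP.+-∸-assoc 1 (NP.≤-pred p)))) (bb-x⁰ m)))) ⟩
      Ycoeff s k ∎
      where
      open QS
      m : ℕ
      m = s ∸ k
      A qT q2 σm σs Ec Bc : Q.PS
      A = Q.const (powR (- z) k)
      qT = Q.monomial (triangle k)
      q2 = gauss i' k
      σm = Q.const (powR (- 1#) m)
      σs = Q.const (powR (- 1#) s)
      Ec = Q.const (dE m + dE (suc m))
      Bc = Q.const (powR d k * powR ur k)
      sc : A Q.*ₚ σm ≈Q Bc Q.*ₚ σs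
      sc = QC.trans (QC.sym (Q.const-*-const _ _))
        (QC.trans (Q.const-cong (trans (powR-neg-* d ur k m)
          (*-congˡ (reflexive (P.cong (powR (- 1#)) (NP.m+[n∸m]≡n (NP.≤-pred p))))))) (Q.const-*-const _ _))

    ΠLin⊗T-x^suc : ∀ s → (ΠLin (suc i') ⊗ T (suc i')) (suc s) ≈Q SQ.Σ (suc s)
      (λ k → qBinomialCoeff z i' k Q.*ₚ Tcoeff (s ∸ k))
    ΠLin⊗T-x^suc s = QC.trans (⊗≈*ₚ (ΠLin (suc i')) (T (suc i')) (suc s))
      (QC.trans (QC.+-cong {SQ.Σ (suc s) (λ k → ΠLin (suc i') k Q.*ₚ T (suc i') (suc s ∸ k))}
        {SQ.Σ (suc s) (λ k → qBinomialCoeff z i' k Q.*ₚ Tcoeff (s ∸ k))}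
          (SQ.Σ-cong< (suc s) (λ k p → QC.*-cong {ΠLin (suc i') k} {qBinomialCoeff z i' k}
            (q-binomial-theorem z i' k) (QC.trans (QC.reflexive
              (P.cong (T (suc i')) (NP.+-∸-assoc 1 (NP.≤-pred p)))) (T-x^suc (s ∸ k)))))
          (QC.trans (QC.*-congˡ {ΠLin (suc i') (suc s)}
            (QC.trans (QC.reflexive (P.cong (T (suc i')) (NP.n∸n≡0 s))) T-x⁰)) (QC.zeroʳ _)))
        (QC.+-identityʳ _))

    T′-x^suc-pad : ∀ s → SQ.Σ (suc (i' ⊓ s)) (Ycoeff s) ≈Q SQ.Σ (suc s) (Ycoeff s)
    T′-x^suc-pad s = QC.sym (QC.trans (SQ.Σ-length (Ycoeff s) (P.sym e))
      (SQ.Σ-pad (suc (i' ⊓ s)) (s ∸ (i' ⊓ s)) beyond))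
      where
      e : suc (i' ⊓ s) ℕ.+ (s ∸ (i' ⊓ s)) ≡ suc s
      e = P.cong suc (NP.m+[n∸m]≡n (NP.m⊓n≤n i' s))
      beyond : ∀ m → suc (i' ⊓ s) ≤ m → m < suc (i' ⊓ s) ℕ.+ (s ∸ (i' ⊓ s)) → Ycoeff s m QC.≈ Q.0ₚ
      beyond m p q = QC.trans (QC.*-congʳ {Q.const (powR (- 1#) s)}
        (QC.trans (QC.*-congʳ {bb (suc s ∸ m) (suc i') 0} (QC.trans (cc-x⁰ m)
                   (QC.trans (QC.*-congˡ {Q.const (powR d m * powR ur m) Q.*ₚ Q.monomial (triangle m)}
                     (gauss-zero i' m im)) (QC.zeroʳ _)))) (QC.zeroˡ (bb (suc s ∸ m) (suc i') 0))))
                       (QC.zeroˡ (Q.const (powR (- 1#) s)))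
        where
        ms : m ≤ s
        ms = NP.≤-pred (P.subst (m <_) e q)
        im : i' < m
        im with i' ℕ.<? m
        ... | yes x = x
        ... | no x = ⊥-elim (NP.<⇒≱ p (NP.⊓-glb (NP.≮⇒≥ x) ms))

    -- By the q-binomial theorem ΠLin (suc i') has x^k-coefficient (-z)^k q^(k(k+1)/2) [i' k]_q;
    -- its convolution with the coefficients Tcoeff of T (suc i') is, term by term,
    -- the double sum T′ (suc i').
    T′≈ΠLin⊗T : T′ (suc i') ≋ ΠLin (suc i') ⊗ T (suc i')
    T′≈ΠLin⊗T zero = QC.trans T′-x⁰ (QC.sym (QC.trans (⊗-x⁰ (ΠLin (suc i')) (T (suc i')))
      (QC.trans (QC.*-congˡ {ΠLin (suc i') 0} T-x⁰) (QC.zeroʳ _))))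
    T′≈ΠLin⊗T (suc s) = QC.trans (T′-x^suc s)
      (QC.trans (T′-x^suc-pad s) (QC.sym (QC.trans (ΠLin⊗T-x^suc s)
        (SQ.Σ-cong< (suc s) (coefficient-match s)))))

  T′-⊗ : ∀ i G → sumS 1 r (λ l → sumS 0 ((i ∸ 1) ⊓ (l ∸ 1)) (λ k →
                   cc k i ⊗ bb (l ∸ k) i ⊗ scal (powR (- 1#) (l ∸ 1)) ⊗ powS X l ⊗ G))
               ≋ T′ i ⊗ G
  T′-⊗ i G = S.trans
    (sumS-cong 1 r {λ l → sumS 0 (bound l) (λ k → W l k ⊗ G)} {λ l → sumS 0 (bound l) (W l) ⊗ G}
       (λ l _ → S.sym (sumS-⊗ʳ 0 (bound (1 ℕ.+ l)) (W (1 ℕ.+ l)) G)))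
    (S.sym (sumS-⊗ʳ 1 r (λ l → sumS 0 (bound l) (W l)) G))
    where
    bound : ℕ → ℕ
    bound l = (i ∸ 1) ⊓ (l ∸ 1)
    W : ℕ → ℕ → Ser
    W l k = cc k i ⊗ bb (l ∸ k) i ⊗ scal (powR (- 1#) (l ∸ 1)) ⊗ powS X l

module Transformation {c ℓ} (R : CommutativeRing c ℓ) (r' : ℕ)
  (u : Vec (CommutativeRing.Carrier R) (suc r')) (d : CommutativeRing.Carrier R) where

  open CommutativeRing R using (Carrier; _*_; -_; 1#)
  open Def R
  open Params r' u d
  open SeriesRing R
  open SeriesOperations R
  open InfiniteProduct R
  open Product (d * ur)
  open LeftHandSide R r' u d
  open RightHandSide R r' u d
  open RingIdentities SerRing
    using (scaled-shift; scaled-term; scaled-product; transfer-forward; transfer-backward)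
  open import Algebra.Properties.Ring S.ring using (x[y-z]≈xy-xz)

  D : Ser
  D = Lin z 0

  L1 : Ser
  L1 = oneS ⊖ X

  Π₁ : ℕ → Ser
  Π₁ i = prodFT 1 (i ∸ 1) (λ h → oneS ⊖ mono 1 h)

  RHS : Ser → Ser
  RHS f = subst f 1 ⊕ sumS 1 r (λ i → T i ⊗ Π₁ i ⊗ subst f i)

  RHS′ : Ser → Ser
  RHS′ F = subst F 1 ⊕ sumS 1 r (λ i → T′ i ⊗ subst F i)

  D-cancel : ∀ h → D ⊗ h ≋ zeroS → h ≋ zeroS
  D-cancel = ⊗-cancel-unit D (Lin-x⁰ z 0)

  PL-cancel : ∀ h → P∞ ⊗ L1 ⊗ h ≋ zeroS → h ≋ zeroS
  PL-cancel = ⊗-cancel-unit (P∞ ⊗ L1)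
    (QC.trans (⊗-x⁰ P∞ L1)
      (QC.trans (QC.*-cong {P∞ 0} {Q.1ₚ} {L1 0} {Q.1ₚ} P∞-x⁰ 1-X-x⁰) (QC.*-identityˡ Q.1ₚ)))

  module _ {f F : Ser} (F≋fP∞ : F ≋ f ⊗ P∞) where

    subst-F : ∀ i → subst F i ≋ subst f i ⊗ subst P∞ i
    subst-F i = S.trans (subst-cong i F≋fP∞) (subst-⊗ f P∞ i)

    term-scaled : ∀ i' → suc i' ≤ r →
      D ⊗ (T′ (suc i') ⊗ subst F (suc i')) ≋ (P∞ ⊗ L1) ⊗ (T (suc i') ⊗ Π₁ (suc i') ⊗ subst f (suc i'))
    term-scaled i' ir =
      scaled-term {D = D} {P = P∞} {L = L1}
        {sf = subst f (suc i')} {sP = subst P∞ (suc i')} {sF = subst F (suc i')} (subst-F (suc i'))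
        {ΠL = ΠLin (suc i')} {T = T (suc i')} {T′ = T′ (suc i')} {Πx = Π₁ (suc i')}
        {Πx₁ = prodS (suc i') (λ h → oneS ⊖ mono 1 h)} {ΠD = prodS (suc i') (Lin z)}
        (AtIndex.T′≈ΠLin⊗T i' ir) (prodFT-head i' (Lin z))
        (P∞-functional-eq-iterated (suc i')) (prodFT-head i' (λ h → oneS ⊖ mono 1 h))

    shift-scaled : D ⊗ subst F 1 ≋ (P∞ ⊗ L1) ⊗ subst f 1
    shift-scaled =
      scaled-shift {D = D} {P = P∞} {L = L1} {sf = subst f 1} {sP = subst P∞ 1} {sF = subst F 1}
        (subst-F 1) P∞-functional-eq

    sum-scaled : D ⊗ sumS 1 r (λ i → T′ i ⊗ subst F i) ≋
                 (P∞ ⊗ L1) ⊗ sumS 1 r (λ i → T i ⊗ Π₁ i ⊗ subst f i)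
    sum-scaled = S.trans (sumS-⊗ˡ 1 r (λ i → T′ i ⊗ subst F i) D)
      (S.trans (sumS-cong₁ r {λ i → D ⊗ (T′ i ⊗ subst F i)}
                             {λ i → (P∞ ⊗ L1) ⊗ (T i ⊗ Π₁ i ⊗ subst f i)} term-scaled)
               (S.sym (sumS-⊗ˡ 1 r (λ i → T i ⊗ Π₁ i ⊗ subst f i) (P∞ ⊗ L1))))

    rhs-scaled : D ⊗ RHS′ F ≋ (P∞ ⊗ L1) ⊗ RHS f
    rhs-scaled = S.trans (S.distribˡ D (subst F 1) (sumS 1 r (λ i → T′ i ⊗ subst F i)))
      (S.trans (S.+-cong shift-scaled sum-scaled)
               (S.sym (S.distribˡ (P∞ ⊗ L1) (subst f 1) (sumS 1 r (λ i → T i ⊗ Π₁ i ⊗ subst f i)))))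

    lhs-scaled : D ⊗ (lhs′ ⊗ F) ≋ (P∞ ⊗ L1) ⊗ (prodVec u oneMinusDX ⊗ f)
    lhs-scaled =
      scaled-product {D = D} {P = P∞} {L = L1} {Π⁻ = Π⁻} {A = prodVec u oneMinusDX} {A′ = lhs′}
        {f = f} {F = F} lhs′-factor F≋fP∞ prodVec-split-last

    equations-scaled : D ⊗ (lhs′ ⊗ F ⊖ RHS′ F) ≋ (P∞ ⊗ L1) ⊗ (prodVec u oneMinusDX ⊗ f ⊖ RHS f)
    equations-scaled = S.trans (x[y-z]≈xy-xz D (lhs′ ⊗ F) (RHS′ F))
      (S.trans (S.+-cong lhs-scaled (⊝-cong rhs-scaled))
               (S.sym (x[y-z]≈xy-xz (P∞ ⊗ L1) (prodVec u oneMinusDX ⊗ f) (RHS f))))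

    EqR′⇔ : EqR' F ⇔ (lhs′ ⊗ F ≋ RHS′ F)
    EqR′⇔ = mk⇔ (λ e → S.trans e rhs≋) (λ e → S.trans e (S.sym rhs≋))
      where
      rhs≋ : subst F 1 ⊕ sumS 1 r (λ i → sumS 1 r (λ l → sumS 0 ((i ∸ 1) ℕ.⊓ (l ∸ 1)) (λ k →
               cc k i ⊗ bb (l ∸ k) i ⊗ scal (powR (- 1#) (l ∸ 1)) ⊗ powS X l ⊗ subst F i)))
             ≋ RHS′ F
      rhs≋ = ⊕-congˡ (subst F 1) (sumS-cong₁ r
        {λ i → sumS 1 r (λ l → sumS 0 ((i ∸ 1) ℕ.⊓ (l ∸ 1)) (λ k →
                 cc k i ⊗ bb (l ∸ k) i ⊗ scal (powR (- 1#) (l ∸ 1)) ⊗ powS X l ⊗ subst F i))}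
        {λ i → T′ i ⊗ subst F i} (λ j _ → T′-⊗ (suc j) (subst F (suc j))))

    EqR⇔EqR′ : EqR f ⇔ EqR' F
    EqR⇔EqR′ = mk⇔
      (λ e → from EqR′⇔ (transfer-forward D-cancel PL-cancel
                           {A = prodVec u oneMinusDX ⊗ f} {B = RHS f} {A′ = lhs′ ⊗ F} {B′ = RHS′ F}
                           equations-scaled e))
      (λ e → transfer-backward D-cancel PL-cancel
               {A = prodVec u oneMinusDX ⊗ f} {B = RHS f} {A′ = lhs′ ⊗ F} {B′ = RHS′ F}
               equations-scaled (to EqR′⇔ e))
      where open Equivalence

    AtZeroOne⇔ : AtZeroOne f ⇔ AtZeroOne F
    AtZeroOne⇔ = mk⇔ (AtZeroOne-resp {f} {F} (QC.sym F-x⁰)) (AtZeroOne-resp {F} {f} F-x⁰)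
      where
      F-x⁰ : F 0 ≈Q f 0
      F-x⁰ = QC.trans (F≋fP∞ 0) (QC.trans (⊗-x⁰ f P∞)
        (QC.trans (QC.*-congˡ {f 0} P∞-x⁰) (QC.*-identityʳ (f 0))))

lemma3p6 : ∀ {c ℓ} (R : CommutativeRing c ℓ) →
    let open CommutativeRing R using (Carrier) in
    let open Def R in
    (r' : ℕ) (u : Vec Carrier (suc r')) (d : Carrier) (f F : Ser) →
    let open Params r' u d in
    F ≋ f ⊗ Pinf →
    ((AtZeroOne f × EqR f) ⇔ (AtZeroOne F × EqR' F))
lemma3p6 R r' u d f F F≋fP = AtZeroOne⇔ F≋fP ×-⇔ EqR⇔EqR′ F≋fP
  where open Transformation R r' u d
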